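{- Let $(\mathcal{A},\varphi,\varphi^\prime)$ be an infinitesimal non-commutative probability space with extensions $\Phi,\Phi^\prime:H\to\mathbb{C}$, and let $\tilde\kappa=\kappa+\hbar\kappa^\prime$, $\tilde\beta=\beta+\hbar\beta^\prime$, $\tilde\rho=\rho+\hbar\rho^\prime$ be the $\mathbb{G}$-valued infinitesimal characters with $\tilde\Phi=\tilde\varepsilon+\tilde\kappa\prec\tilde\Phi$, $\tilde\Phi=\tilde\varepsilon+\tilde\Phi\succ\tilde\beta$, $\tilde\Phi=\exp^\star(\tilde\rho)$, where $\tilde\Phi=\Phi+\hbar\Phi^\prime$. Then $$\Phi^\prime=\Phi\star\theta_\Phi(\kappa^\prime)=\theta_{\Phi^{ -1}}(\beta^\prime)\star\Phi=\Phi\star W_\rho(\rho^\prime).$$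
   Context: An infinitesimal non-commutative probability space is $(\mathcal{A},\varphi,\varphi^\prime)$ with $\mathcal{A}$ a unital complex algebra, $\varphi,\varphi^\prime$ linear, $\varphi(1)=1$, $\varphi^\prime(1)=0$. $\mathbb{G}=\{z+\hbar w\}$, $\hbar^2=0$. $H=T(T_+(\mathcal{A}))$: words $a_1\cdots a_n$, product $w_1|w_2$, unit $\mathbf1$. For $S\subseteq[n]$, $a_S$ is the subword indexed by $S$ ($a_\emptyset=\mathbf1$), $J_1,\dots,J_k$ the maximal intervals of $[n]\setminus S$ in order; $\Delta(a_1\cdots a_n)=\sum_{S\subseteq[n]}a_S\otimes a_{J_1}|\cdots|a_{J_k}$, multiplicative, $\Delta(\mathbf1)=\mathbf1\otimes\mathbf1$; $\Delta_\prec$ (resp. $\Delta_\succ$) is the part with $1\in S$ (resp. $1\notin S$), extended by $\Delta_{\prec/\succ}(w_1|w_2)=\Delta_{\prec/\succ}(w_1)\Delta(w_2)$. For linear maps $f,g$ from $H$ to $\mathbb{C}$ or $\mathbb{G}$: $f\star g=m(f\otimes g)\Delta$, $f\prec g=m(f\otimes g)\Delta_\prec$, $f\succ g=m(f\otimes g)\Delta_\succ$; $\varepsilon,\tilde\varepsilon$ denote the counit (1 on $\mathbf1$, 0 elsewhere); $\exp^\star(a)=\varepsilon+\sum_{n\ge1}a^{\star n}/n!$; $\Phi^{ -1}$ is the $\star$-inverse. Infinitesimal characters vanish on $\mathbf1$ and on products $w_1|w_2$ of non-unit elements. Extensions: $\Phi$ is the multiplicative map with $\Phi(\mathbf1)=1$,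 $\Phi(a_1\cdots a_n)=\varphi(a_1\cdots a_n)$; $\Phi^\prime$ is linear with $\Phi^\prime(a_1\cdots a_n)=\varphi^\prime(a_1\cdots a_n)$, $\Phi^\prime(\mathbf1)=0$, $\Phi^\prime(w_1|w_2)=\Phi(w_1)\Phi^\prime(w_2)+\Phi^\prime(w_1)\Phi(w_2)$. Shuffle adjoint action: for a character $\Psi:H\to\mathbb{C}$ and linear $\alpha$, $\theta_\Psi(\alpha)=\Psi^{ -1}\succ\alpha\prec\Psi$ ($=(\Psi^{ -1}\succ\alpha)\prec\Psi=\Psi^{ -1}\succ(\alpha\prec\Psi)$). $\mathrm{Ad}_\rho(x)=\rho\star x-x\star\rho$, $\mathrm{Ad}^{(n)}_\rho=\mathrm{Ad}_\rho\circ\mathrm{Ad}^{(n-1)}_\rho$, and $W_\rho(x)=x+\sum_{n>0}\frac{(-1)^n}{(n+1)!}\mathrm{Ad}^{(n)}_\rho(x)$. -}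

module Defs where

open import Level using (Level; _⊔_)
open import Data.Nat using (ℕ; zero; suc) renaming (_+_ to _+ℕ_)
open import Data.Bool using (Bool; true; false)
open import Data.List using (List; []; _∷_; _++_; map; concatMap; length; foldr; upTo)
open import Data.List.NonEmpty using (List⁺; _∷_; toList) renaming (length to length⁺)
open import Data.Product using (_×_; _,_; proj₁; proj₂)
open import Relation.Binary.Core using (Rel)
open import Algebra.Bundles using (CommutativeRing; Monoid)
open import Algebra.Bundles.Raw using (RawRing)

-- The Hopf algebra H = T(T₊(A)) on its basis.
-- A basis element of H is a product w₁|⋯|wₖ of non-empty words wᵢ over A;
-- it is represented by the list (w₁ ∷ ⋯ ∷ wₖ ∷ []); the unit 𝟏 is [].
-- Linear maps H → R are represented by their values on this basis
-- (i.e. as functions H → R).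

module Words {a : Level} (A : Set a) where

  Word : Set a
  Word = List⁺ A

  H : Set a
  H = List Word

  -- all subsets S ⊆ [n], as characteristic Bool-lists of length n
  choices : ℕ → List (List Bool)
  choices zero    = [] ∷ []
  choices (suc n) = map (true ∷_) (choices n) ++ map (false ∷_) (choices n)

  select : List Bool → List A → List A
  select (true  ∷ bs) (x ∷ xs) = x ∷ select bs xs
  select (false ∷ bs) (x ∷ xs) = select bs xs
  select _            _        = []

  consHead : A → List (List A) → List (List A)
  consHead x []       = (x ∷ []) ∷ []
  consHead x (g ∷ gs) = (x ∷ g) ∷ gs

  gaps : List Bool → List A → List (List A)
  gaps (true  ∷ bs) (x ∷ xs) = [] ∷ gaps bs xs
  gaps (false ∷ bs) (x ∷ xs) = consHead x (gaps bs xs)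
  gaps _            _        = [] ∷ []

  toH : List A → H
  toH []       = []
  toH (x ∷ xs) = (x ∷ xs) ∷ []

  -- a_{J₁}|⋯|a_{Jₖ} for the maximal intervals J₁,…,Jₖ of [n] ∖ S
  intervals : List Bool → List A → H
  intervals bs w = concatMap toH (gaps bs w)

  term : Word → List Bool → H × H
  term w bs = toH (select bs (toList w)) , intervals bs (toList w)

  Δw : Word → List (H × H)
  Δw w = map (term w) (choices (length⁺ w))

  Δ≺w : Word → List (H × H)
  Δ≺w (x ∷ xs) = map (term (x ∷ xs)) (map (true ∷_) (choices (length xs)))

  Δ≻w : Word → List (H × H)
  Δ≻w (x ∷ xs) = map (term (x ∷ xs)) (map (false ∷_) (choices (length xs)))

  -- product in H ⊗ H of two sums of basis tensors
  mulΔ : List (H × H) → List (H × H) → List (H × H)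
  mulΔ p q = concatMap (λ u → map (λ v → (proj₁ u ++ proj₁ v , proj₂ u ++ proj₂ v)) q) p

  Δ : H → List (H × H)
  Δ []       = ([] , []) ∷ []
  Δ (w ∷ ws) = mulΔ (Δw w) (Δ ws)

  -- Δ≺(w₁|w₂) = Δ≺(w₁)Δ(w₂); convention Δ≺(𝟏) = Δ≻(𝟏) = 0
  Δ≺ : H → List (H × H)
  Δ≺ []       = []
  Δ≺ (w ∷ ws) = mulΔ (Δ≺w w) (Δ ws)

  Δ≻ : H → List (H × H)
  Δ≻ []       = []
  Δ≻ (w ∷ ws) = mulΔ (Δ≻w w) (Δ ws)

  deg : H → ℕ
  deg []       = 0
  deg (w ∷ ws) = length⁺ w +ℕ deg ws

module Conv {a c ℓ : Level} (A : Set a) (R : RawRing c ℓ) where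
  open Words A public
  open RawRing R

  Map : Set (a ⊔ c)
  Map = H → Carrier

  sumL : List Carrier → Carrier
  sumL = foldr _+_ 0#

  conv : (H → List (H × H)) → Map → Map → Map
  conv D f g x = sumL (map (λ p → f (proj₁ p) * g (proj₂ p)) (D x))

  infixl 7 _⋆_ _≺_ _≻_
  infixl 6 _⊕_ _⊖_
  infix 4 _≐_

  _⋆_ _≺_ _≻_ : Map → Map → Map
  _⋆_ = conv Δ
  _≺_ = conv Δ≺
  _≻_ = conv Δ≻

  ε : Map
  ε []      = 1#
  ε (_ ∷ _) = 0#

  _⊕_ _⊖_ : Map → Map → Map
  (f ⊕ g) x = f x + g x
  (f ⊖ g) x = f x + - g x

  _≐_ : Map → Map → Set (a ⊔ ℓ)
  f ≐ g = ∀ x → f x ≈ g x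

  IsInfChar : Map → Set (a ⊔ ℓ)
  IsInfChar α = (α [] ≈ 0#) × (∀ w v vs → α (w ∷ v ∷ vs) ≈ 0#)

  pow : ℕ → Map → Map
  pow zero    α = ε
  pow (suc n) α = α ⋆ pow n α

  -- exp⋆(α) = ε + Σ_{n≥1} α^{⋆n}/n!, given invFact n = 1/n!.
  -- For α vanishing on 𝟏 (e.g. an infinitesimal character), α^{⋆n}(x) = 0
  -- when n > deg x, so the series is the finite sum below.
  exp⋆ : (ℕ → Carrier) → Map → Map
  exp⋆ invFact α x = sumL (map (λ n → invFact n * pow n α x) (upTo (suc (deg x))))

  θ : (Ψinv Ψ : Map) → Map → Map
  θ Ψinv Ψ α = (Ψinv ≻ α) ≺ Ψ

  Ad : Map → Map → Map
  Ad ρ x = (ρ ⋆ x) ⊖ (x ⋆ ρ)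

  AdN : ℕ → Map → Map → Map
  AdN zero    ρ x = x
  AdN (suc n) ρ x = Ad ρ (AdN n ρ x)

  negPow : ℕ → Carrier → Carrier
  negPow zero    r = r
  negPow (suc n) r = - negPow n r

  -- W_ρ(x) = x + Σ_{n>0} (-1)^n/(n+1)! Ad^{(n)}_ρ(x), given invFact n = 1/n!.
  -- For ρ vanishing on 𝟏, Ad^{(n)}_ρ(x)(h) = 0 when n > deg h, so the
  -- series is the finite sum below.
  W : (ℕ → Carrier) → Map → Map → Map
  W invFact ρ x h =
    x h + sumL (map (λ n → negPow (suc n) (invFact (suc (suc n)) * AdN (suc n) ρ x h))
                    (upTo (deg h)))

-- Dual numbers 𝔾 = R[ħ]/(ħ²) over a commutative ring, as a raw ring:
-- (z , w) stands for z + ħ w.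

module _ {c ℓ : Level} (K : CommutativeRing c ℓ) where
  open CommutativeRing K

  Dual : RawRing c ℓ
  Dual = record
    { Carrier = Carrier × Carrier
    ; _≈_     = λ x y → (proj₁ x ≈ proj₁ y) × (proj₂ x ≈ proj₂ y)
    ; _+_     = λ x y → (proj₁ x + proj₁ y , proj₂ x + proj₂ y)
    ; _*_     = λ x y → (proj₁ x * proj₁ y , proj₁ x * proj₂ y + proj₂ x * proj₁ y)
    ; -_      = λ x → (- proj₁ x , - proj₂ x)
    ; 0#      = (0# , 0#)
    ; 1#      = (1# , 0#)
    }

  natK : ℕ → Carrier
  natK zero    = 0#
  natK (suc n) = 1# + natK n

  -- 1/n!, given inv n = 1/(n+1)
  invFactK : (ℕ → Carrier) → ℕ → Carrier
  invFactK inv zero    = 1#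
  invFactK inv (suc n) = inv n * invFactK inv n

  invFactG : (ℕ → Carrier) → ℕ → Carrier × Carrier
  invFactG inv n = (invFactK inv n , 0#)

  lift : {x : Level} {X : Set x} → (X → Carrier) → (X → Carrier) → X → Carrier × Carrier
  lift f f' x = (f x , f' x)

module Extensions {a ℓa c ℓ : Level} (K : CommutativeRing c ℓ) (𝒜 : Monoid a ℓa)
                  (φ φ' : Monoid.Carrier 𝒜 → CommutativeRing.Carrier K) where
  open CommutativeRing K
  open Monoid 𝒜 renaming (Carrier to A; ε to 1A)
  open Words A

  prodW : Word → A
  prodW (x ∷ xs) = go x xs
    where
    go : A → List A → A
    go y []       = y
    go y (z ∷ zs) = y ∙ go z zs

  Φ : H → Carrier
  Φ []           = 1#
  Φ (w ∷ [])     = φ (prodW w)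
  Φ (w ∷ v ∷ vs) = φ (prodW w) * Φ (v ∷ vs)

  Φ' : H → Carrier
  Φ' []           = 0#
  Φ' (w ∷ [])     = φ' (prodW w)
  Φ' (w ∷ v ∷ vs) = Φ (w ∷ []) * Φ' (v ∷ vs) + Φ' (w ∷ []) * Φ (v ∷ vs)

module Submission where

open import Level using (Level; _⊔_)
open import Data.Nat using (ℕ; zero; suc; _<_; _≤_; z≤n; s≤s; s≤s⁻¹; _∸_; _<?_) renaming (_+_ to _+ℕ_)
import Data.Nat.Properties as NP
open import Data.Bool using (Bool; true; false)
open import Data.Maybe using (Maybe; just; nothing)
open import Data.List using (List; []; _∷_; _++_; map; concatMap; foldr; length; applyUpTo; upTo)
open import Data.List.Properties using (++-assoc; ++-identityʳ; concatMap-++)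
open import Data.List.NonEmpty using (_∷_; toList)
open import Data.List.Relation.Unary.All as All using (All; []; _∷_)
import Data.List.Relation.Unary.All.Properties as AllP
open import Function using (_∘_)
open import Data.Product using (_×_; _,_; proj₁; proj₂; ∃₂; uncurry)
open import Relation.Binary.PropositionalEquality as P using (_≡_)
open import Relation.Nullary using (yes; no)
open import Data.Empty using (⊥-elim)
open import Algebra.Bundles using (CommutativeRing; Monoid)
open import Defs

-- All three identities come from comparing ħ-coefficients in the equations defining κ̃, β̃ and ρ̃.
-- For κ′ (and symmetrically β′), Φ′ solves the linear equation X = κ ≺ X + κ′ ≺ Φ, whose solution is unique by
-- induction on the number of letters, and the dendriform laws (a ≺ b) ≺ c = a ≺ (b ⋆ c), (a ≻ b) ≺ c = a ≻ (b ≺ c)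
-- and (a ⋆ b) ≻ c = a ≻ (b ≻ c) show that Φ ⋆ θ_Φ(κ′) solves it as well. For ρ′, the ħ-coefficient of ρ̃^⋆(k+1) is
-- Σ_{p+q=k} ρ^p ⋆ ρ′ ⋆ ρ^q, and the identity e^ρ ⋆ e^(-ad ρ)(ρ′) = ρ′ ⋆ e^ρ, read degree by degree, regroups
-- Σ_k Σ_{p+q=k} ρ^p ⋆ ρ′ ⋆ ρ^q / (k+1)! into e^ρ ⋆ W_ρ(ρ′).
-- The dendriform laws are inherited from the coassociativity of a simpler coproduct on "barred words", through
-- which Δ, Δ≺ and Δ≻ all factor: there every letter goes to exactly one side and every bar to both.

module Sums {c ℓ : Level} (K : CommutativeRing c ℓ) where
  open CommutativeRing K
  open import Algebra.Properties.CommutativeSemigroup +-commutativeSemigroup using (interchange; x∙yz≈y∙xz)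
  open import Relation.Binary.Reasoning.Setoid setoid

  ∑ : ∀ {b} {X : Set b} → List X → (X → Carrier) → Carrier
  ∑ xs f = foldr _+_ 0# (map f xs)

  ∑₂ : ∀ {b} {X : Set b} → List (X × X) → (X → X → Carrier) → Carrier
  ∑₂ ps F = ∑ ps (λ p → F (proj₁ p) (proj₂ p))

  ∑-cong : ∀ {b} {X : Set b} (xs : List X) {f g : X → Carrier} → (∀ x → f x ≈ g x) → ∑ xs f ≈ ∑ xs g
  ∑-cong []       e = refl
  ∑-cong (x ∷ xs) e = +-cong (e x) (∑-cong xs e)

  ∑-cong-All : ∀ {b} {X : Set b} {xs : List X} {f g : X → Carrier} → All (λ x → f x ≈ g x) xs → ∑ xs f ≈ ∑ xs g
  ∑-cong-All []       = refl
  ∑-cong-All (e ∷ es) = +-cong e (∑-cong-All es)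

  ∑-zero : ∀ {b} {X : Set b} (xs : List X) {f : X → Carrier} → (∀ x → f x ≈ 0#) → ∑ xs f ≈ 0#
  ∑-zero []       e = refl
  ∑-zero (x ∷ xs) e = trans (+-cong (e x) (∑-zero xs e)) (+-identityˡ _)

  ∑-zero-All : ∀ {b} {X : Set b} {xs : List X} {f : X → Carrier} → All (λ x → f x ≈ 0#) xs → ∑ xs f ≈ 0#
  ∑-zero-All []       = refl
  ∑-zero-All (e ∷ es) = trans (+-cong e (∑-zero-All es)) (+-identityˡ _)

  ∑-++ : ∀ {b} {X : Set b} (xs ys : List X) (f : X → Carrier) → ∑ (xs ++ ys) f ≈ ∑ xs f + ∑ ys f
  ∑-++ []       ys f = sym (+-identityˡ _)
  ∑-++ (x ∷ xs) ys f = trans (+-congˡ (∑-++ xs ys f)) (sym (+-assoc _ _ _))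

  ∑-map : ∀ {b d} {X : Set b} {Y : Set d} (g : X → Y) (xs : List X) (f : Y → Carrier) →
          ∑ (map g xs) f ≈ ∑ xs (λ x → f (g x))
  ∑-map g []       f = refl
  ∑-map g (x ∷ xs) f = +-congˡ (∑-map g xs f)

  ∑-concatMap : ∀ {b d} {X : Set b} {Y : Set d} (g : X → List Y) (xs : List X) (f : Y → Carrier) →
                ∑ (concatMap g xs) f ≈ ∑ xs (λ x → ∑ (g x) f)
  ∑-concatMap g []       f = refl
  ∑-concatMap g (x ∷ xs) f = trans (∑-++ (g x) (concatMap g xs) f) (+-congˡ (∑-concatMap g xs f))

  ∑-+ : ∀ {b} {X : Set b} (xs : List X) (f g : X → Carrier) → ∑ xs (λ x → f x + g x) ≈ ∑ xs f + ∑ xs g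
  ∑-+ []       f g = sym (+-identityˡ _)
  ∑-+ (x ∷ xs) f g = trans (+-congˡ (∑-+ xs f g)) (interchange _ _ _ _)

  *-distribˡ-∑ : ∀ {b} {X : Set b} (k : Carrier) (xs : List X) (f : X → Carrier) → k * ∑ xs f ≈ ∑ xs (λ x → k * f x)
  *-distribˡ-∑ k []       f = zeroʳ k
  *-distribˡ-∑ k (x ∷ xs) f = trans (distribˡ k _ _) (+-congˡ (*-distribˡ-∑ k xs f))

  *-distribʳ-∑ : ∀ {b} {X : Set b} (k : Carrier) (xs : List X) (f : X → Carrier) → ∑ xs f * k ≈ ∑ xs (λ x → f x * k)
  *-distribʳ-∑ k []       f = zeroˡ k
  *-distribʳ-∑ k (x ∷ xs) f = trans (distribʳ k _ _) (+-congˡ (*-distribʳ-∑ k xs f))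

  ∑-comm : ∀ {b d} {X : Set b} {Y : Set d} (xs : List X) (ys : List Y) (f : X → Y → Carrier) →
           ∑ xs (λ x → ∑ ys (f x)) ≈ ∑ ys (λ y → ∑ xs (λ x → f x y))
  ∑-comm []       ys f = sym (∑-zero ys (λ _ → refl))
  ∑-comm (x ∷ xs) ys f = trans (+-congˡ (∑-comm xs ys f)) (sym (∑-+ ys _ _))

  ∑< : ℕ → (ℕ → Carrier) → Carrier
  ∑< n g = ∑ (upTo n) g

  ∑-applyUpTo : ∀ n (f : ℕ → ℕ) g → ∑ (applyUpTo f n) g ≈ ∑< n (λ i → g (f i))
  ∑-applyUpTo zero    f g = refl
  ∑-applyUpTo (suc n) f g =
    +-congˡ (trans (∑-applyUpTo n (λ i → f (suc i)) g) (sym (∑-applyUpTo n suc (λ i → g (f i)))))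

  ∑<-cong : ∀ n {f g} → (∀ i → f i ≈ g i) → ∑< n f ≈ ∑< n g
  ∑<-cong n = ∑-cong (upTo n)

  ∑<-suc : ∀ n g → ∑< (suc n) g ≈ g 0 + ∑< n (λ i → g (suc i))
  ∑<-suc n g = +-congˡ (∑-applyUpTo n suc g)

  ∑<-sucʳ : ∀ n g → ∑< (suc n) g ≈ ∑< n g + g n
  ∑<-sucʳ zero    g = trans (+-identityʳ _) (sym (+-identityˡ _))
  ∑<-sucʳ (suc n) g = begin
    ∑< (suc (suc n)) g                          ≈⟨ ∑<-suc (suc n) g ⟩
    g 0 + ∑< (suc n) (λ i → g (suc i))           ≈⟨ +-congˡ (∑<-sucʳ n (λ i → g (suc i))) ⟩
    g 0 + (∑< n (λ i → g (suc i)) + g (suc n))   ≈⟨ sym (+-assoc _ _ _) ⟩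
    (g 0 + ∑< n (λ i → g (suc i))) + g (suc n)   ≈⟨ +-congʳ (sym (∑<-suc n g)) ⟩
    ∑< (suc n) g + g (suc n)                    ∎

  ∑<-+-vanishing : ∀ B e g → (∀ m → B ≤ m → g m ≈ 0#) → ∑< (B +ℕ e) g ≈ ∑< B g
  ∑<-+-vanishing B zero    g z = reflexive (P.cong (λ n → ∑< n g) (NP.+-identityʳ B))
  ∑<-+-vanishing B (suc e) g z = begin
    ∑< (B +ℕ suc e) g            ≡⟨ P.cong (λ n → ∑< n g) (NP.+-suc B e) ⟩
    ∑< (suc (B +ℕ e)) g          ≈⟨ ∑<-sucʳ (B +ℕ e) g ⟩
    ∑< (B +ℕ e) g + g (B +ℕ e)   ≈⟨ +-cong (∑<-+-vanishing B e g z) (z (B +ℕ e) (NP.m≤m+n B e)) ⟩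
    ∑< B g + 0#                  ≈⟨ +-identityʳ _ ⟩
    ∑< B g                       ∎

  ∑<-truncate : ∀ B Q g → B ≤ Q → (∀ m → B ≤ m → g m ≈ 0#) → ∑< Q g ≈ ∑< B g
  ∑<-truncate B Q g le z = P.subst (λ n → ∑< n g ≈ ∑< B g) (NP.m+[n∸m]≡n le) (∑<-+-vanishing B (Q ∸ B) g z)

  antidiagonal : ℕ → List (ℕ × ℕ)
  antidiagonal zero    = (0 , 0) ∷ []
  antidiagonal (suc k) = (0 , suc k) ∷ map (λ am → (suc (proj₁ am) , proj₂ am)) (antidiagonal k)

  antidiagonal-sum : ∀ k → All (λ am → proj₁ am +ℕ proj₂ am ≡ k) (antidiagonal k)
  antidiagonal-sum zero    = P.refl ∷ []
  antidiagonal-sum (suc k) = P.refl ∷ AllP.map⁺ (All.map (P.cong suc) (antidiagonal-sum k))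

  ∑ᵃ : ℕ → (ℕ → ℕ → Carrier) → Carrier
  ∑ᵃ k F = ∑ (antidiagonal k) (λ am → F (proj₁ am) (proj₂ am))

  ∑ᵃ-cong : ∀ k {F G : ℕ → ℕ → Carrier} → (∀ a m → F a m ≈ G a m) → ∑ᵃ k F ≈ ∑ᵃ k G
  ∑ᵃ-cong k e = ∑-cong (antidiagonal k) (λ am → e (proj₁ am) (proj₂ am))

  ∑ᵃ-suc : ∀ k F → ∑ᵃ (suc k) F ≈ F 0 (suc k) + ∑ᵃ k (λ a m → F (suc a) m)
  ∑ᵃ-suc k F = +-congˡ (∑-map _ (antidiagonal k) _)

  ∑ᵃ-sucʳ : ∀ k F → ∑ᵃ (suc k) F ≈ F (suc k) 0 + ∑ᵃ k (λ a m → F a (suc m))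
  ∑ᵃ-sucʳ zero    F = trans (sym (+-assoc _ _ _)) (trans (+-congʳ (+-comm _ _)) (+-assoc _ _ _))
  ∑ᵃ-sucʳ (suc k) F = begin
    ∑ᵃ (suc (suc k)) F                                           ≈⟨ ∑ᵃ-suc (suc k) F ⟩
    F 0 (suc (suc k)) + ∑ᵃ (suc k) (λ a m → F (suc a) m)          ≈⟨ +-congˡ (∑ᵃ-sucʳ k (λ a m → F (suc a) m)) ⟩
    F 0 (suc (suc k)) + (F (suc (suc k)) 0 + X)                  ≈⟨ x∙yz≈y∙xz _ _ _ ⟩
    F (suc (suc k)) 0 + (F 0 (suc (suc k)) + X)                  ≈⟨ +-congˡ (sym (∑ᵃ-suc k (λ a m → F a (suc m)))) ⟩
    F (suc (suc k)) 0 + ∑ᵃ (suc k) (λ a m → F a (suc m))          ∎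
    where
    X : Carrier
    X = ∑ᵃ k (λ a m → F (suc a) (suc m))

  ∑<-∑<-by-antidiagonals : ∀ B P Q (T : ℕ → ℕ → Carrier) → B ≤ P → B ≤ Q → (∀ a m → B ≤ a +ℕ m → T a m ≈ 0#) →
                           ∑< P (λ a → ∑< Q (T a)) ≈ ∑< B (λ k → ∑ᵃ k T)
  ∑<-∑<-by-antidiagonals zero    P       Q T _         _   z = ∑-zero (upTo P) (λ a → ∑-zero (upTo Q) (λ m → z a m z≤n))
  ∑<-∑<-by-antidiagonals (suc B) (suc P) Q T (s≤s B≤P) B<Q z = begin
    ∑< (suc P) (λ a → ∑< Q (T a))                                       ≈⟨ ∑<-suc P _ ⟩
    ∑< Q (T 0) + ∑< P (λ a → ∑< Q (T (suc a)))
      ≈⟨ +-cong (∑<-truncate (suc B) Q (T 0) B<Q (z 0))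
                (∑<-∑<-by-antidiagonals B P Q (λ a → T (suc a)) B≤P (NP.≤-trans (NP.n≤1+n B) B<Q) (λ a m → z (suc a) m ∘ s≤s)) ⟩
    ∑< (suc B) (T 0) + ∑< B (λ k → ∑ᵃ k (λ a → T (suc a)))                ≈⟨ +-congʳ (∑<-suc B (T 0)) ⟩
    (T 0 0 + ∑< B (λ k → T 0 (suc k))) + ∑< B (λ k → ∑ᵃ k (λ a → T (suc a))) ≈⟨ +-assoc _ _ _ ⟩
    T 0 0 + (∑< B (λ k → T 0 (suc k)) + ∑< B (λ k → ∑ᵃ k (λ a → T (suc a)))) ≈⟨ +-congˡ (sym (∑-+ (upTo B) _ _)) ⟩
    T 0 0 + ∑< B (λ k → T 0 (suc k) + ∑ᵃ k (λ a → T (suc a)))              ≈⟨ +-congˡ (∑<-cong B (λ k → sym (∑ᵃ-suc k T))) ⟩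
    T 0 0 + ∑< B (λ k → ∑ᵃ (suc k) T)                                    ≈⟨ +-congʳ (sym (+-identityʳ _)) ⟩
    ∑ᵃ 0 T + ∑< B (λ k → ∑ᵃ (suc k) T)                                   ≈⟨ sym (∑<-suc B _) ⟩
    ∑< (suc B) (λ k → ∑ᵃ k T)                                            ∎

module Factorials {c ℓ : Level} (K : CommutativeRing c ℓ) where
  open CommutativeRing K
  open Sums K
  open import Relation.Binary.Reasoning.Setoid setoid
  open import Algebra.Properties.Ring ring using (-‿+-comm; -1*x≈-x; -‿involutive)
  open import Algebra.Solver.CommutativeMonoid *-commutativeMonoid using (solve; _⊕_; _⊜_)

  ⌜_⌝ : ℕ → Carrier
  ⌜_⌝ = natK K

  ⌜⌝-+ : ∀ m n → ⌜ m +ℕ n ⌝ ≈ ⌜ m ⌝ + ⌜ n ⌝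
  ⌜⌝-+ zero    n = sym (+-identityˡ _)
  ⌜⌝-+ (suc m) n = trans (+-congˡ (⌜⌝-+ m n)) (sym (+-assoc _ _ _))

  ⌜⌝*∑ᵃ : ∀ j n F → ⌜ j +ℕ n ⌝ * ∑ᵃ n F ≈ ∑ᵃ n (λ a m → ⌜ a ⌝ * F a m) + ∑ᵃ n (λ a m → ⌜ j +ℕ m ⌝ * F a m)
  ⌜⌝*∑ᵃ j n F = trans (*-distribˡ-∑ ⌜ j +ℕ n ⌝ (antidiagonal n) _)
    (trans (∑-cong-All (All.map (λ {am} e → trans (*-congʳ (weight am e)) (distribʳ _ _ _)) (antidiagonal-sum n)))
           (∑-+ (antidiagonal n) _ _))
    where
    weight : ∀ am → proj₁ am +ℕ proj₂ am ≡ n → ⌜ j +ℕ n ⌝ ≈ ⌜ proj₁ am ⌝ + ⌜ j +ℕ proj₂ am ⌝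
    weight (a , m) e = trans (reflexive (P.cong ⌜_⌝ j+n≡a+[j+m])) (⌜⌝-+ a (j +ℕ m))
      where
      j+n≡a+[j+m] : j +ℕ n ≡ a +ℕ (j +ℕ m)
      j+n≡a+[j+m] = P.trans (P.cong (j +ℕ_) (P.sym e))
                      (P.trans (P.sym (NP.+-assoc j a m)) (P.trans (P.cong (_+ℕ m) (NP.+-comm j a)) (NP.+-assoc a j m)))

  sign : ℕ → Carrier
  sign zero    = 1#
  sign (suc m) = - 1# * sign m

  u+-1*[u-w]≈w : ∀ u w → u + - 1# * (u + - w) ≈ w
  u+-1*[u-w]≈w u w = begin
    u + - 1# * (u + - w)  ≈⟨ +-congˡ (-1*x≈-x _) ⟩
    u + - (u + - w)       ≈⟨ +-congˡ (sym (-‿+-comm _ _)) ⟩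
    u + (- u + - - w)     ≈⟨ +-congˡ (+-congˡ (-‿involutive w)) ⟩
    u + (- u + w)         ≈⟨ sym (+-assoc _ _ _) ⟩
    (u + - u) + w         ≈⟨ +-congʳ (-‿inverseʳ u) ⟩
    0# + w                ≈⟨ +-identityˡ w ⟩
    w                     ∎

  module InvFact (inv : ℕ → Carrier) (inv-spec : ∀ n → ⌜ suc n ⌝ * inv n ≈ 1#) where

    invFact : ℕ → Carrier
    invFact = invFactK K inv

    ⌜suc⌝*invFact-suc : ∀ n → ⌜ suc n ⌝ * invFact (suc n) ≈ invFact n
    ⌜suc⌝*invFact-suc n = trans (sym (*-assoc _ _ _)) (trans (*-congʳ (inv-spec n)) (*-identityˡ _))

    invFact*≈⌜suc⌝*invFact-suc* : ∀ n u → invFact n * u ≈ ⌜ suc n ⌝ * (invFact (suc n) * u)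
    invFact*≈⌜suc⌝*invFact-suc* n u = trans (*-congʳ (sym (⌜suc⌝*invFact-suc n))) (*-assoc _ _ _)

    ⌜suc⌝*-cancel : ∀ n {u v} → ⌜ suc n ⌝ * u ≈ ⌜ suc n ⌝ * v → u ≈ v
    ⌜suc⌝*-cancel n {u} {v} e = begin
      u                          ≈⟨ sym (*-identityˡ u) ⟩
      1# * u                     ≈⟨ *-congʳ (sym inv*⌜suc⌝≈1) ⟩
      (inv n * ⌜ suc n ⌝) * u    ≈⟨ *-assoc _ _ _ ⟩
      inv n * (⌜ suc n ⌝ * u)    ≈⟨ *-congˡ e ⟩
      inv n * (⌜ suc n ⌝ * v)    ≈⟨ sym (*-assoc _ _ _) ⟩
      (inv n * ⌜ suc n ⌝) * v    ≈⟨ *-congʳ inv*⌜suc⌝≈1 ⟩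
      1# * v                     ≈⟨ *-identityˡ v ⟩
      v                          ∎
      where
      inv*⌜suc⌝≈1 : inv n * ⌜ suc n ⌝ ≈ 1#
      inv*⌜suc⌝≈1 = trans (*-comm _ _) (inv-spec n)

    invFact-1 : invFact 1 ≈ 1#
    invFact-1 = trans (*-identityʳ _) (trans (sym (*-identityˡ _)) (trans (*-congʳ (sym (+-identityʳ 1#))) (inv-spec 0)))

    -- cV a m = (-1)ᵐ/(a! m!) and cP a m = (-1)ᵐ/(a! (m+1)!) are the coefficients of e^r ⋆ e^(-ad r) and of e^r ⋆ W.
    cV cP : ℕ → ℕ → Carrier
    cV a m = invFact a * (sign m * invFact m)
    cP a m = invFact a * (sign m * invFact (suc m))

    cV-sucˡ : ∀ a m → ⌜ suc a ⌝ * cV (suc a) m ≈ cV a m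
    cV-sucˡ a m = trans (sym (*-assoc _ _ _)) (*-congʳ (⌜suc⌝*invFact-suc a))

    cP-sucˡ : ∀ a m → ⌜ suc a ⌝ * cP (suc a) m ≈ cP a m
    cP-sucˡ a m = trans (sym (*-assoc _ _ _)) (*-congʳ (⌜suc⌝*invFact-suc a))

    cV-sucʳ : ∀ a m → ⌜ suc m ⌝ * cV a (suc m) ≈ - 1# * cV a m
    cV-sucʳ a m = trans
      (solve 5 (λ k i n s c → k ⊕ (i ⊕ ((n ⊕ s) ⊕ c)) ⊜ n ⊕ (i ⊕ (s ⊕ (k ⊕ c)))) refl
               ⌜ suc m ⌝ (invFact a) (- 1#) (sign m) (invFact (suc m)))
      (*-congˡ (*-congˡ (*-congˡ (⌜suc⌝*invFact-suc m))))

    cP-weight : ∀ a m → ⌜ suc m ⌝ * cP a m ≈ cV a m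
    cP-weight a m = trans
      (solve 4 (λ k i s c → k ⊕ (i ⊕ (s ⊕ c)) ⊜ i ⊕ (s ⊕ (k ⊕ c))) refl ⌜ suc m ⌝ (invFact a) (sign m) (invFact (suc m)))
      (*-congˡ (*-congˡ (⌜suc⌝*invFact-suc m)))

    cP-product : ∀ a m u v → (invFact a * u) * (sign m * (invFact (suc m) * v)) ≈ cP a m * (u * v)
    cP-product a m = solve 5 (λ i s c u v → (i ⊕ u) ⊕ (s ⊕ (c ⊕ v)) ⊜ (i ⊕ (s ⊕ c)) ⊕ (u ⊕ v)) refl
                             (invFact a) (sign m) (invFact (suc m))

module Convolution {a c ℓ : Level} (K : CommutativeRing c ℓ) (A : Set a) where
  open CommutativeRing K
  open Conv A rawRing
  open Sums K
  open Factorials K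
  open import Algebra.Properties.CommutativeSemigroup +-commutativeSemigroup using (interchange)
  open import Algebra.Properties.CommutativeSemigroup *-commutativeSemigroup using () renaming (x∙yz≈y∙xz to x*yz≈y*xz)
  open import Relation.Binary.Reasoning.Setoid setoid
  open import Algebra.Properties.Ring ring using (-‿distribʳ-*; -‿+-comm; -0#≈0#; -1*x≈-x)
  module G = Conv A (Dual K)

  -- `nothing` is a bar; `read` cuts a barred word at its bars and drops the empty blocks.
  Barred : Set a
  Barred = List (Maybe A)

  Barred² : Set a
  Barred² = Barred × Barred

  blocks : Barred → List (List A)
  blocks []            = [] ∷ []
  blocks (nothing ∷ s) = [] ∷ blocks s
  blocks (just x ∷ s)  = consHead x (blocks s)

  read : Barred → H
  read s = concatMap toH (blocks s)

  Δᵇ : Barred → List Barred²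
  Δᵇ []            = ([] , []) ∷ []
  Δᵇ (nothing ∷ s) = map (λ p → (nothing ∷ proj₁ p , nothing ∷ proj₂ p)) (Δᵇ s)
  Δᵇ (just x ∷ s)  = map (λ p → (just x ∷ proj₁ p , nothing ∷ proj₂ p)) (Δᵇ s)
                  ++ map (λ p → (proj₁ p , just x ∷ proj₂ p)) (Δᵇ s)

  ∑-Δᵇ-bar : ∀ s (F : Barred² → Carrier) →
             ∑ (Δᵇ (nothing ∷ s)) F ≈ ∑ (Δᵇ s) (λ p → F (nothing ∷ proj₁ p , nothing ∷ proj₂ p))
  ∑-Δᵇ-bar s F = ∑-map (λ p → (nothing ∷ proj₁ p , nothing ∷ proj₂ p)) (Δᵇ s) F

  ∑-Δᵇ-letter : ∀ x s (F : Barred² → Carrier) → ∑ (Δᵇ (just x ∷ s)) F ≈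
                ∑ (Δᵇ s) (λ p → F (just x ∷ proj₁ p , nothing ∷ proj₂ p)) + ∑ (Δᵇ s) (λ p → F (proj₁ p , just x ∷ proj₂ p))
  ∑-Δᵇ-letter x s F = trans (∑-++ (map left (Δᵇ s)) (map right (Δᵇ s)) F) (+-cong (∑-map left (Δᵇ s) F) (∑-map right (Δᵇ s) F))
    where
    left right : Barred² → Barred²
    left  p = (just x ∷ proj₁ p , nothing ∷ proj₂ p)
    right p = (proj₁ p , just x ∷ proj₂ p)

  Δᵇ-coassoc : ∀ s (G : Barred → Barred → Barred → Carrier) →
               ∑₂ (Δᵇ s) (λ l r → ∑₂ (Δᵇ l) (λ l′ m → G l′ m r)) ≈
               ∑₂ (Δᵇ s) (λ l r → ∑₂ (Δᵇ r) (λ m r′ → G l m r′))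
  Δᵇ-coassoc []            G = refl
  Δᵇ-coassoc (nothing ∷ s) G = begin
    ∑₂ (Δᵇ (nothing ∷ s)) (λ l r → ∑₂ (Δᵇ l) (λ l′ m → G l′ m r))
      ≈⟨ ∑-Δᵇ-bar s _ ⟩
    ∑₂ (Δᵇ s) (λ l r → ∑₂ (Δᵇ (nothing ∷ l)) (λ l′ m → G l′ m (nothing ∷ r)))
      ≈⟨ ∑-cong (Δᵇ s) (λ p → ∑-Δᵇ-bar (proj₁ p) _) ⟩
    ∑₂ (Δᵇ s) (λ l r → ∑₂ (Δᵇ l) (λ l′ m → G′ l′ m r))
      ≈⟨ Δᵇ-coassoc s G′ ⟩
    ∑₂ (Δᵇ s) (λ l r → ∑₂ (Δᵇ r) (λ m r′ → G′ l m r′))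
      ≈⟨ ∑-cong (Δᵇ s) (λ p → sym (∑-Δᵇ-bar (proj₂ p) _)) ⟩
    ∑₂ (Δᵇ s) (λ l r → ∑₂ (Δᵇ (nothing ∷ r)) (λ m r′ → G (nothing ∷ l) m r′))
      ≈⟨ sym (∑-Δᵇ-bar s _) ⟩
    ∑₂ (Δᵇ (nothing ∷ s)) (λ l r → ∑₂ (Δᵇ r) (λ m r′ → G l m r′)) ∎
    where
    G′ : Barred → Barred → Barred → Carrier
    G′ l m r = G (nothing ∷ l) (nothing ∷ m) (nothing ∷ r)
  Δᵇ-coassoc (just x ∷ s) G = begin
    ∑₂ (Δᵇ (just x ∷ s)) (λ l r → ∑₂ (Δᵇ l) (λ l′ m → G l′ m r))
      ≈⟨ ∑-Δᵇ-letter x s _ ⟩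
    ∑₂ (Δᵇ s) (λ l r → ∑₂ (Δᵇ (just x ∷ l)) (λ l′ m → G l′ m (nothing ∷ r))) + L G₃
      ≈⟨ +-congʳ (trans (∑-cong (Δᵇ s) (λ p → ∑-Δᵇ-letter x (proj₁ p) _)) (∑-+ (Δᵇ s) _ _)) ⟩
    (L G₁ + L G₂) + L G₃
      ≈⟨ +-assoc _ _ _ ⟩
    L G₁ + (L G₂ + L G₃)
      ≈⟨ +-cong (Δᵇ-coassoc s G₁) (+-cong (Δᵇ-coassoc s G₂) (Δᵇ-coassoc s G₃)) ⟩
    R G₁ + (R G₂ + R G₃)
      ≈⟨ +-cong (∑-cong (Δᵇ s) (λ p → sym (∑-Δᵇ-bar (proj₂ p) _)))
                (trans (sym (∑-+ (Δᵇ s) _ _)) (∑-cong (Δᵇ s) (λ p → sym (∑-Δᵇ-letter x (proj₂ p) _)))) ⟩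
    ∑₂ (Δᵇ s) (λ l r → ∑₂ (Δᵇ (nothing ∷ r)) (λ m r′ → G (just x ∷ l) m r′))
      + ∑₂ (Δᵇ s) (λ l r → ∑₂ (Δᵇ (just x ∷ r)) (λ m r′ → G l m r′))
      ≈⟨ sym (∑-Δᵇ-letter x s _) ⟩
    ∑₂ (Δᵇ (just x ∷ s)) (λ l r → ∑₂ (Δᵇ r) (λ m r′ → G l m r′)) ∎
    where
    G₁ G₂ G₃ : Barred → Barred → Barred → Carrier
    G₁ l m r = G (just x ∷ l) (nothing ∷ m) (nothing ∷ r)
    G₂ l m r = G l (just x ∷ m) (nothing ∷ r)
    G₃ l m r = G l m (just x ∷ r)
    L R : (Barred → Barred → Barred → Carrier) → Carrier
    L G′ = ∑₂ (Δᵇ s) (λ l r → ∑₂ (Δᵇ l) (λ l′ m → G′ l′ m r))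
    R G′ = ∑₂ (Δᵇ s) (λ l r → ∑₂ (Δᵇ r) (λ m r′ → G′ l m r′))

  blocks-nonempty : ∀ s → ∃₂ λ g gs → blocks s ≡ g ∷ gs
  blocks-nonempty []            = [] , [] , P.refl
  blocks-nonempty (nothing ∷ s) = [] , blocks s , P.refl
  blocks-nonempty (just x ∷ s) with blocks s | blocks-nonempty s
  ... | _ | g , gs , P.refl = x ∷ g , gs , P.refl

  blocks-++-bar : ∀ s₁ s₂ → blocks (s₁ ++ nothing ∷ s₂) ≡ blocks s₁ ++ blocks s₂
  blocks-++-bar []             s₂ = P.refl
  blocks-++-bar (nothing ∷ s₁) s₂ = P.cong ([] ∷_) (blocks-++-bar s₁ s₂)
  blocks-++-bar (just x ∷ s₁)  s₂ rewrite blocks-++-bar s₁ s₂ with blocks s₁ | blocks-nonempty s₁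
  ... | _ | g , gs , P.refl = P.refl

  read-++-bar : ∀ s₁ s₂ → read (s₁ ++ nothing ∷ s₂) ≡ read s₁ ++ read s₂
  read-++-bar s₁ s₂ = P.trans (P.cong (concatMap toH) (blocks-++-bar s₁ s₂)) (concatMap-++ toH (blocks s₁) (blocks s₂))

  read-++-++-bar : ∀ s₀ s₁ s₂ → read (s₀ ++ (s₁ ++ nothing ∷ s₂)) ≡ read (s₀ ++ s₁) ++ read s₂
  read-++-++-bar s₀ s₁ s₂ = P.trans (P.cong read (P.sym (++-assoc s₀ s₁ _))) (read-++-bar (s₀ ++ s₁) s₂)

  blocks-letters : ∀ u → blocks (map just u) ≡ u ∷ []
  blocks-letters []      = P.refl
  blocks-letters (x ∷ u) rewrite blocks-letters u = P.refl

  read-letters : ∀ u → read (map just u) ≡ toH u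
  read-letters u rewrite blocks-letters u = ++-identityʳ (toH u)

  read-letters-++-bar : ∀ u s → read (map just u ++ nothing ∷ s) ≡ toH u ++ read s
  read-letters-++-bar u s = P.trans (read-++-bar (map just u) s) (P.cong (_++ read s) (read-letters u))

  encode : H → Barred
  encode []       = []
  encode (w ∷ ws) = map just (toList w) ++ nothing ∷ encode ws

  encodeTail : List A → H → Barred
  encodeTail xs ws = map just xs ++ nothing ∷ encode ws

  read-encode : ∀ h → read (encode h) ≡ h
  read-encode []       = P.refl
  read-encode (w ∷ ws) = P.trans (read-letters-++-bar (toList w) (encode ws)) (P.cong (w ∷_) (read-encode ws))

  gapsBarred : List Bool → List A → Barred
  gapsBarred (true  ∷ bs) (x ∷ xs) = nothing ∷ gapsBarred bs xs
  gapsBarred (false ∷ bs) (x ∷ xs) = just x ∷ gapsBarred bs xs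
  gapsBarred _            _        = []

  blocks-gapsBarred : ∀ bs u → blocks (gapsBarred bs u) ≡ gaps bs u
  blocks-gapsBarred []           u       = P.refl
  blocks-gapsBarred (true  ∷ bs) []      = P.refl
  blocks-gapsBarred (true  ∷ bs) (x ∷ u) = P.cong ([] ∷_) (blocks-gapsBarred bs u)
  blocks-gapsBarred (false ∷ bs) []      = P.refl
  blocks-gapsBarred (false ∷ bs) (x ∷ u) = P.cong (consHead x) (blocks-gapsBarred bs u)

  read-gapsBarred : ∀ bs u → read (gapsBarred bs u) ≡ intervals bs u
  read-gapsBarred bs u = P.cong (concatMap toH) (blocks-gapsBarred bs u)

  read-letter-gapsBarred : ∀ x bs u → read (just x ∷ gapsBarred bs u) ≡ concatMap toH (consHead x (gaps bs u))
  read-letter-gapsBarred x bs u = P.cong (λ z → concatMap toH (consHead x z)) (blocks-gapsBarred bs u)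

  ∑-choices-Δᵇ : ∀ u (G : Barred → Barred → Carrier) →
       ∑ (choices (length u)) (λ bs → G (map just (select bs u)) (gapsBarred bs u)) ≈ ∑ (Δᵇ (map just u)) (λ p → G (proj₁ p) (proj₂ p))
  ∑-choices-Δᵇ [] G = refl
  ∑-choices-Δᵇ (x ∷ u) G = begin
    ∑ (map (true ∷_) C ++ map (false ∷_) C) (λ bs → G (map just (select bs (x ∷ u))) (gapsBarred bs (x ∷ u)))
      ≈⟨ ∑-++ (map (true ∷_) C) (map (false ∷_) C) _ ⟩
    ∑ (map (true ∷_) C) (λ bs → G (map just (select bs (x ∷ u))) (gapsBarred bs (x ∷ u)))
      + ∑ (map (false ∷_) C) (λ bs → G (map just (select bs (x ∷ u))) (gapsBarred bs (x ∷ u)))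
      ≈⟨ +-cong (∑-map (true ∷_) C _) (∑-map (false ∷_) C _) ⟩
    ∑ C (λ bs → G (just x ∷ map just (select bs u)) (nothing ∷ gapsBarred bs u))
      + ∑ C (λ bs → G (map just (select bs u)) (just x ∷ gapsBarred bs u))
      ≈⟨ +-cong (∑-choices-Δᵇ u (λ a b → G (just x ∷ a) (nothing ∷ b))) (∑-choices-Δᵇ u (λ a b → G a (just x ∷ b))) ⟩
    ∑ (Δᵇ (map just u)) (λ p → G (just x ∷ proj₁ p) (nothing ∷ proj₂ p))
      + ∑ (Δᵇ (map just u)) (λ p → G (proj₁ p) (just x ∷ proj₂ p))
      ≈⟨ sym (∑-Δᵇ-letter x (map just u) _) ⟩
    ∑ (Δᵇ (just x ∷ map just u)) (λ p → G (proj₁ p) (proj₂ p)) ∎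
    where
    C : List (List Bool)
    C = choices (length u)

  ∑-Δᵇ-++ : ∀ s₁ s₂ (G : Barred² → Carrier) →
            ∑ (Δᵇ (s₁ ++ s₂)) G ≈ ∑ (Δᵇ s₁) (λ p → ∑ (Δᵇ s₂) (λ q → G (proj₁ p ++ proj₁ q , proj₂ p ++ proj₂ q)))
  ∑-Δᵇ-++ []             s₂ G = sym (+-identityʳ _)
  ∑-Δᵇ-++ (nothing ∷ s₁) s₂ G = trans (∑-Δᵇ-bar (s₁ ++ s₂) G) (trans (∑-Δᵇ-++ s₁ s₂ _) (sym (∑-Δᵇ-bar s₁ _)))
  ∑-Δᵇ-++ (just x ∷ s₁)  s₂ G =
    trans (∑-Δᵇ-letter x (s₁ ++ s₂) G) (trans (+-cong (∑-Δᵇ-++ s₁ s₂ _) (∑-Δᵇ-++ s₁ s₂ _)) (sym (∑-Δᵇ-letter x s₁ _)))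

  ∑-mulΔ : ∀ (Q R : List (H × H)) (F : H → H → Carrier) →
           ∑₂ (mulΔ Q R) F ≈ ∑₂ Q (λ l r → ∑₂ R (λ l′ r′ → F (l ++ l′) (r ++ r′)))
  ∑-mulΔ Q R F = trans (∑-concatMap _ Q _) (∑-cong Q (λ _ → ∑-map _ R _))

  ∑-mulΔ-Δ[] : ∀ (Q : List (H × H)) F → ∑₂ (mulΔ Q (Δ [])) F ≈ ∑₂ Q F
  ∑-mulΔ-Δ[] Q F = trans (∑-mulΔ Q (Δ []) F)
    (∑-cong Q (λ q → trans (+-identityʳ _) (reflexive (P.cong₂ F (++-identityʳ (proj₁ q)) (++-identityʳ (proj₂ q))))))

  ∑-Δ-++ : ∀ u v (F : H → H → Carrier) →
           ∑₂ (Δ (u ++ v)) F ≈ ∑₂ (Δ u) (λ l r → ∑₂ (Δ v) (λ l′ r′ → F (l ++ l′) (r ++ r′)))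
  ∑-Δ-++ []      v F = sym (+-identityʳ _)
  ∑-Δ-++ (w ∷ u) v F = begin
    ∑₂ (mulΔ (Δw w) (Δ (u ++ v))) F
      ≈⟨ ∑-mulΔ (Δw w) (Δ (u ++ v)) F ⟩
    ∑₂ (Δw w) (λ l r → ∑₂ (Δ (u ++ v)) (λ l′ r′ → F (l ++ l′) (r ++ r′)))
      ≈⟨ ∑-cong (Δw w) (λ _ → ∑-Δ-++ u v _) ⟩
    ∑₂ (Δw w) (λ l r → ∑₂ (Δ u) (λ l′ r′ → ∑₂ (Δ v) (λ l″ r″ → F (l ++ (l′ ++ l″)) (r ++ (r′ ++ r″)))))
      ≈⟨ ∑-cong (Δw w) (λ a → ∑-cong (Δ u) (λ _ → ∑-cong (Δ v) (λ _ →
           reflexive (P.cong₂ F (P.sym (++-assoc (proj₁ a) _ _)) (P.sym (++-assoc (proj₂ a) _ _)))))) ⟩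
    ∑₂ (Δw w) (λ l r → ∑₂ (Δ u) (λ l′ r′ → ∑₂ (Δ v) (λ l″ r″ → F ((l ++ l′) ++ l″) ((r ++ r′) ++ r″))))
      ≈⟨ sym (∑-mulΔ (Δw w) (Δ u) _) ⟩
    ∑₂ (mulΔ (Δw w) (Δ u)) (λ l r → ∑₂ (Δ v) (λ l′ r′ → F (l ++ l′) (r ++ r′))) ∎

  ∑-Δ-word : ∀ u (F : H → H → Carrier) → ∑₂ (Δ (toH u)) F ≈ ∑₂ (Δᵇ (map just u)) (λ l r → F (read l) (read r))
  ∑-Δ-word []       F = refl
  ∑-Δ-word (x ∷ xs) F = begin
    ∑₂ (mulΔ (Δw (x ∷ xs)) (Δ [])) F
      ≈⟨ ∑-mulΔ-Δ[] (Δw (x ∷ xs)) F ⟩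
    ∑₂ (Δw (x ∷ xs)) F
      ≈⟨ ∑-map (term (x ∷ xs)) C _ ⟩
    ∑ C (λ bs → F (toH (select bs (x ∷ xs))) (intervals bs (x ∷ xs)))
      ≈⟨ ∑-cong C (λ bs → reflexive (P.cong₂ F (P.sym (read-letters (select bs (x ∷ xs)))) (P.sym (read-gapsBarred bs (x ∷ xs))))) ⟩
    ∑ C (λ bs → F (read (map just (select bs (x ∷ xs)))) (read (gapsBarred bs (x ∷ xs))))
      ≈⟨ ∑-choices-Δᵇ (x ∷ xs) (λ l r → F (read l) (read r)) ⟩
    ∑₂ (Δᵇ (map just (x ∷ xs))) (λ l r → F (read l) (read r)) ∎
    where
    C : List (List Bool)
    C = choices (length (x ∷ xs))

  ∑-Δ≺w : ∀ x u (F : H → H → Carrier) → ∑₂ (Δ≺w (x ∷ u)) F ≈ ∑₂ (Δᵇ (map just u)) (λ l r → F (read (just x ∷ l)) (read r))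
  ∑-Δ≺w x u F = begin
    ∑₂ (map (term (x ∷ u)) (map (true ∷_) C)) F
      ≈⟨ trans (∑-map (term (x ∷ u)) (map (true ∷_) C) _) (∑-map (true ∷_) C _) ⟩
    ∑ C (λ bs → F (toH (x ∷ select bs u)) (intervals bs u))
      ≈⟨ ∑-cong C (λ bs → reflexive (P.cong₂ F (P.sym (read-letters (x ∷ select bs u))) (P.sym (read-gapsBarred bs u)))) ⟩
    ∑ C (λ bs → F (read (just x ∷ map just (select bs u))) (read (gapsBarred bs u)))
      ≈⟨ ∑-choices-Δᵇ u (λ l r → F (read (just x ∷ l)) (read r)) ⟩
    ∑₂ (Δᵇ (map just u)) (λ l r → F (read (just x ∷ l)) (read r)) ∎
    where
    C : List (List Bool)
    C = choices (length u)

  ∑-Δ≻w : ∀ x u (F : H → H → Carrier) → ∑₂ (Δ≻w (x ∷ u)) F ≈ ∑₂ (Δᵇ (map just u)) (λ l r → F (read l) (read (just x ∷ r)))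
  ∑-Δ≻w x u F = begin
    ∑₂ (map (term (x ∷ u)) (map (false ∷_) C)) F
      ≈⟨ trans (∑-map (term (x ∷ u)) (map (false ∷_) C) _) (∑-map (false ∷_) C _) ⟩
    ∑ C (λ bs → F (toH (select bs u)) (concatMap toH (consHead x (gaps bs u))))
      ≈⟨ ∑-cong C (λ bs → reflexive (P.cong₂ F (P.sym (read-letters (select bs u))) (P.sym (read-letter-gapsBarred x bs u)))) ⟩
    ∑ C (λ bs → F (read (map just (select bs u))) (read (just x ∷ gapsBarred bs u)))
      ≈⟨ ∑-choices-Δᵇ u (λ l r → F (read l) (read (just x ∷ r))) ⟩
    ∑₂ (Δᵇ (map just u)) (λ l r → F (read l) (read (just x ∷ r))) ∎
    where
    C : List (List Bool)
    C = choices (length u)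

  infixr 5 _∣_
  data Blocks : Barred → Set a where
    lastBlock : ∀ u → Blocks (map just u)
    _∣_       : ∀ u {s} → Blocks s → Blocks (map just u ++ nothing ∷ s)

  blocksView : ∀ s → Blocks s
  blocksView []            = lastBlock []
  blocksView (nothing ∷ s) = [] ∣ blocksView s
  blocksView (just x ∷ s) with blocksView s
  ... | lastBlock u = lastBlock (x ∷ u)
  ... | u ∣ b       = (x ∷ u) ∣ b

  -- The step shared by Δ, Δ≺ and Δ≻: Q is the coproduct of the first word u, whose factors are read behind f₀ and g₀.
  ∑-prefix-read : ∀ (Q : List (H × H)) u (f₀ g₀ : Barred) →
    (∀ G → ∑₂ Q G ≈ ∑₂ (Δᵇ u) (λ l r → G (read (f₀ ++ l)) (read (g₀ ++ r)))) →
    ∀ s → (∀ G → ∑₂ (Δ (read s)) G ≈ ∑₂ (Δᵇ s) (λ l r → G (read l) (read r))) → ∀ F →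
    ∑₂ Q (λ l r → ∑₂ (Δ (read s)) (λ l′ r′ → F (l ++ l′) (r ++ r′))) ≈
    ∑₂ (Δᵇ (u ++ nothing ∷ s)) (λ l r → F (read (f₀ ++ l)) (read (g₀ ++ r)))
  ∑-prefix-read Q u f₀ g₀ ∑Q s ∑s F = begin
    ∑₂ Q (λ l r → ∑₂ (Δ (read s)) (λ l′ r′ → F (l ++ l′) (r ++ r′)))
      ≈⟨ ∑-cong Q (λ _ → ∑s _) ⟩
    ∑₂ Q (λ l r → ∑₂ (Δᵇ s) (λ l′ r′ → F (l ++ read l′) (r ++ read r′)))
      ≈⟨ ∑Q _ ⟩
    ∑₂ (Δᵇ u) (λ l r → ∑₂ (Δᵇ s) (λ l′ r′ → F (read (f₀ ++ l) ++ read l′) (read (g₀ ++ r) ++ read r′)))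
      ≈⟨ ∑-cong (Δᵇ u) (λ a → trans
           (∑-cong (Δᵇ s) (λ b → reflexive (P.sym (P.cong₂ F (read-++-++-bar f₀ (proj₁ a) (proj₁ b))
                                                             (read-++-++-bar g₀ (proj₂ a) (proj₂ b))))))
           (sym (∑-Δᵇ-bar s _))) ⟩
    ∑₂ (Δᵇ u) (λ l r → ∑₂ (Δᵇ (nothing ∷ s)) (λ l′ r′ → F (read (f₀ ++ (l ++ l′))) (read (g₀ ++ (r ++ r′)))))
      ≈⟨ sym (∑-Δᵇ-++ u (nothing ∷ s) _) ⟩
    ∑₂ (Δᵇ (u ++ nothing ∷ s)) (λ l r → F (read (f₀ ++ l)) (read (g₀ ++ r))) ∎

  ∑-Δ-blocks : ∀ {s} → Blocks s → ∀ (F : H → H → Carrier) → ∑₂ (Δ (read s)) F ≈ ∑₂ (Δᵇ s) (λ l r → F (read l) (read r))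
  ∑-Δ-blocks (lastBlock u) F =
    trans (reflexive (P.cong (λ h → ∑₂ (Δ h) F) (read-letters u))) (∑-Δ-word u F)
  ∑-Δ-blocks (_∣_ u {s} b) F = begin
    ∑₂ (Δ (read (map just u ++ nothing ∷ s))) F
      ≡⟨ P.cong (λ h → ∑₂ (Δ h) F) (read-letters-++-bar u s) ⟩
    ∑₂ (Δ (toH u ++ read s)) F
      ≈⟨ ∑-Δ-++ (toH u) (read s) F ⟩
    ∑₂ (Δ (toH u)) (λ l r → ∑₂ (Δ (read s)) (λ l′ r′ → F (l ++ l′) (r ++ r′)))
      ≈⟨ ∑-prefix-read (Δ (toH u)) (map just u) [] [] (∑-Δ-word u) s (∑-Δ-blocks b) F ⟩
    ∑₂ (Δᵇ (map just u ++ nothing ∷ s)) (λ l r → F (read l) (read r)) ∎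

  ∑-Δ-read : ∀ s (F : H → H → Carrier) → ∑₂ (Δ (read s)) F ≈ ∑₂ (Δᵇ s) (λ l r → F (read l) (read r))
  ∑-Δ-read s = ∑-Δ-blocks (blocksView s)

  ∑-firstWord-read : ∀ (D : H → List (H × H)) (Dw : Word → List (H × H)) →
    (∀ w ws → D (w ∷ ws) ≡ mulΔ (Dw w) (Δ ws)) → ∀ x (f₀ g₀ : Barred) →
    (∀ u G → ∑₂ (Dw (x ∷ u)) G ≈ ∑₂ (Δᵇ (map just u)) (λ l r → G (read (f₀ ++ l)) (read (g₀ ++ r)))) →
    ∀ s F → ∑₂ (D (read (just x ∷ s))) F ≈ ∑₂ (Δᵇ s) (λ l r → F (read (f₀ ++ l)) (read (g₀ ++ r)))
  ∑-firstWord-read D Dw D-cons x f₀ g₀ ∑Dw s F with blocksView s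
  ... | lastBlock u = begin
    ∑₂ (D (read (map just (x ∷ u)))) F  ≡⟨ P.cong (λ h → ∑₂ (D h) F) (read-letters (x ∷ u)) ⟩
    ∑₂ (D ((x ∷ u) ∷ [])) F             ≡⟨ P.cong (λ Q → ∑₂ Q F) (D-cons (x ∷ u) []) ⟩
    ∑₂ (mulΔ (Dw (x ∷ u)) (Δ [])) F     ≈⟨ ∑-mulΔ-Δ[] (Dw (x ∷ u)) F ⟩
    ∑₂ (Dw (x ∷ u)) F                   ≈⟨ ∑Dw u F ⟩
    ∑₂ (Δᵇ (map just u)) (λ l r → F (read (f₀ ++ l)) (read (g₀ ++ r))) ∎
  ... | _∣_ u {s′} b = begin
    ∑₂ (D (read (map just (x ∷ u) ++ nothing ∷ s′))) F
      ≡⟨ P.cong (λ h → ∑₂ (D h) F) (read-letters-++-bar (x ∷ u) s′) ⟩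
    ∑₂ (D ((x ∷ u) ∷ read s′)) F
      ≡⟨ P.cong (λ Q → ∑₂ Q F) (D-cons (x ∷ u) (read s′)) ⟩
    ∑₂ (mulΔ (Dw (x ∷ u)) (Δ (read s′))) F
      ≈⟨ ∑-mulΔ (Dw (x ∷ u)) (Δ (read s′)) F ⟩
    ∑₂ (Dw (x ∷ u)) (λ l r → ∑₂ (Δ (read s′)) (λ l′ r′ → F (l ++ l′) (r ++ r′)))
      ≈⟨ ∑-prefix-read (Dw (x ∷ u)) (map just u) f₀ g₀ (∑Dw u) s′ (∑-Δ-blocks b) F ⟩
    ∑₂ (Δᵇ (map just u ++ nothing ∷ s′)) (λ l r → F (read (f₀ ++ l)) (read (g₀ ++ r))) ∎

  ∑-Δ≺-read : ∀ x s (F : H → H → Carrier) →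
              ∑₂ (Δ≺ (read (just x ∷ s))) F ≈ ∑₂ (Δᵇ s) (λ l r → F (read (just x ∷ l)) (read r))
  ∑-Δ≺-read x = ∑-firstWord-read Δ≺ Δ≺w (λ _ _ → P.refl) x (just x ∷ []) [] (∑-Δ≺w x)

  ∑-Δ≻-read : ∀ x s (F : H → H → Carrier) →
              ∑₂ (Δ≻ (read (just x ∷ s))) F ≈ ∑₂ (Δᵇ s) (λ l r → F (read l) (read (just x ∷ r)))
  ∑-Δ≻-read x = ∑-firstWord-read Δ≻ Δ≻w (λ _ _ → P.refl) x [] (just x ∷ []) (∑-Δ≻w x)

  ∑-Δ-encode : ∀ h (F : H → H → Carrier) → ∑₂ (Δ h) F ≈ ∑₂ (Δᵇ (encode h)) (λ l r → F (read l) (read r))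
  ∑-Δ-encode h F = trans (reflexive (P.cong (λ h′ → ∑₂ (Δ h′) F) (P.sym (read-encode h)))) (∑-Δ-read (encode h) F)

  ∑-Δ≺-encode : ∀ x xs ws (F : H → H → Carrier) →
                ∑₂ (Δ≺ ((x ∷ xs) ∷ ws)) F ≈ ∑₂ (Δᵇ (encodeTail xs ws)) (λ l r → F (read (just x ∷ l)) (read r))
  ∑-Δ≺-encode x xs ws F =
    trans (reflexive (P.cong (λ h → ∑₂ (Δ≺ h) F) (P.sym (read-encode ((x ∷ xs) ∷ ws))))) (∑-Δ≺-read x (encodeTail xs ws) F)

  ∑-Δ≻-encode : ∀ x xs ws (F : H → H → Carrier) →
                ∑₂ (Δ≻ ((x ∷ xs) ∷ ws)) F ≈ ∑₂ (Δᵇ (encodeTail xs ws)) (λ l r → F (read l) (read (just x ∷ r)))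
  ∑-Δ≻-encode x xs ws F =
    trans (reflexive (P.cong (λ h → ∑₂ (Δ≻ h) F) (P.sym (read-encode ((x ∷ xs) ∷ ws))))) (∑-Δ≻-read x (encodeTail xs ws) F)

  Map³ : Set (a ⊔ c)
  Map³ = H → H → H → Carrier

  record ReadsAs (D : H → List (H × H)) (p₀ f₀ g₀ : Barred) : Set (a ⊔ c ⊔ ℓ) where
    constructor readsAs
    field
      ∑-reads : ∀ s (F : H → H → Carrier) →
                ∑₂ (D (read (p₀ ++ s))) F ≈ ∑₂ (Δᵇ s) (λ l r → F (read (f₀ ++ l)) (read (g₀ ++ r)))

  CoassocAt : (D₁ D₂ D₃ D₄ : H → List (H × H)) → H → Set (a ⊔ c ⊔ ℓ)
  CoassocAt D₁ D₂ D₃ D₄ h = ∀ (F : Map³) →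
    ∑₂ (D₂ h) (λ l r → ∑₂ (D₁ l) (λ l′ m → F l′ m r)) ≈ ∑₂ (D₃ h) (λ l r → ∑₂ (D₄ r) (λ m r′ → F l m r′))

  -- All four laws are instances of the coassociativity of Δᵇ, once the prefixes produced on each side match.
  coassoc-via-read : ∀ {D₁ D₂ D₃ D₄ : H → List (H × H)} {p₀ a₀ b₀ c₀ d₀ e₀ : Barred} →
    ReadsAs D₂ p₀ d₀ c₀ → ReadsAs D₁ d₀ a₀ b₀ → ReadsAs D₃ p₀ a₀ e₀ → ReadsAs D₄ e₀ b₀ c₀ →
    ∀ s {h} → read (p₀ ++ s) ≡ h → CoassocAt D₁ D₂ D₃ D₄ h
  coassoc-via-read {D₁} {D₂} {D₃} {D₄} {p₀} {a₀} {b₀} {c₀} {d₀} {e₀}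
                   (readsAs R₂) (readsAs R₁) (readsAs R₃) (readsAs R₄) s P.refl F = begin
    ∑₂ (D₂ (read (p₀ ++ s))) (λ l r → ∑₂ (D₁ l) (λ l′ m → F l′ m r))
      ≈⟨ R₂ s _ ⟩
    ∑₂ (Δᵇ s) (λ l r → ∑₂ (D₁ (read (d₀ ++ l))) (λ l′ m → F l′ m (read (c₀ ++ r))))
      ≈⟨ ∑-cong (Δᵇ s) (λ p → R₁ (proj₁ p) _) ⟩
    ∑₂ (Δᵇ s) (λ l r → ∑₂ (Δᵇ l) (λ l′ m → G l′ m r))
      ≈⟨ Δᵇ-coassoc s G ⟩
    ∑₂ (Δᵇ s) (λ l r → ∑₂ (Δᵇ r) (λ m r′ → G l m r′))
      ≈⟨ ∑-cong (Δᵇ s) (λ p → sym (R₄ (proj₂ p) _)) ⟩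
    ∑₂ (Δᵇ s) (λ l r → ∑₂ (D₄ (read (e₀ ++ r))) (λ m r′ → F (read (a₀ ++ l)) m r′))
      ≈⟨ sym (R₃ s _) ⟩
    ∑₂ (D₃ (read (p₀ ++ s))) (λ l r → ∑₂ (D₄ r) (λ m r′ → F l m r′)) ∎
    where
    G : Barred → Barred → Barred → Carrier
    G l m r = F (read (a₀ ++ l)) (read (b₀ ++ m)) (read (c₀ ++ r))

  Δ-reads : ReadsAs Δ [] [] []
  Δ-reads = readsAs ∑-Δ-read

  Δ≺-reads : ∀ x → ReadsAs Δ≺ (just x ∷ []) (just x ∷ []) []
  Δ≺-reads x = readsAs (∑-Δ≺-read x)

  Δ≻-reads : ∀ x → ReadsAs Δ≻ (just x ∷ []) [] (just x ∷ [])
  Δ≻-reads x = readsAs (∑-Δ≻-read x)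

  Δ-coassoc : ∀ h → CoassocAt Δ Δ Δ Δ h
  Δ-coassoc h = coassoc-via-read Δ-reads Δ-reads Δ-reads Δ-reads (encode h) (read-encode h)

  Δ≺-coassoc : ∀ h → CoassocAt Δ≺ Δ≺ Δ≺ Δ h
  Δ≺-coassoc []              F = refl
  Δ≺-coassoc ((x ∷ xs) ∷ ws)   =
    coassoc-via-read (Δ≺-reads x) (Δ≺-reads x) (Δ≺-reads x) Δ-reads
      (encodeTail xs ws) (read-encode ((x ∷ xs) ∷ ws))

  Δ≻≺-coassoc : ∀ h → CoassocAt Δ≻ Δ≺ Δ≻ Δ≺ h
  Δ≻≺-coassoc []              F = refl
  Δ≻≺-coassoc ((x ∷ xs) ∷ ws)   =
    coassoc-via-read (Δ≺-reads x) (Δ≻-reads x) (Δ≻-reads x) (Δ≺-reads x)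
      (encodeTail xs ws) (read-encode ((x ∷ xs) ∷ ws))

  Δ≻-coassoc : ∀ h → CoassocAt Δ Δ≻ Δ≻ Δ≻ h
  Δ≻-coassoc []              F = refl
  Δ≻-coassoc ((x ∷ xs) ∷ ws)   =
    coassoc-via-read (Δ≻-reads x) Δ-reads (Δ≻-reads x) (Δ≻-reads x)
      (encodeTail xs ws) (read-encode ((x ∷ xs) ∷ ws))

  conv-assoc : ∀ (D₁ D₂ D₃ D₄ : H → List (H × H)) → (∀ h → CoassocAt D₁ D₂ D₃ D₄ h) →
               ∀ f g k → conv D₂ (conv D₁ f g) k ≐ conv D₃ f (conv D₄ g k)
  conv-assoc D₁ D₂ D₃ D₄ coassoc f g k h = begin
    ∑₂ (D₂ h) (λ l r → ∑₂ (D₁ l) (λ l′ m → f l′ * g m) * k r)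
      ≈⟨ ∑-cong (D₂ h) (λ p → *-distribʳ-∑ (k (proj₂ p)) (D₁ (proj₁ p)) _) ⟩
    ∑₂ (D₂ h) (λ l r → ∑₂ (D₁ l) (λ l′ m → f l′ * g m * k r))
      ≈⟨ coassoc h (λ l m r → f l * g m * k r) ⟩
    ∑₂ (D₃ h) (λ l r → ∑₂ (D₄ r) (λ m r′ → f l * g m * k r′))
      ≈⟨ ∑-cong (D₃ h) (λ p → trans (∑-cong (D₄ (proj₂ p)) (λ _ → *-assoc _ _ _))
                                    (sym (*-distribˡ-∑ (f (proj₁ p)) (D₄ (proj₂ p)) _))) ⟩
    ∑₂ (D₃ h) (λ l r → f l * ∑₂ (D₄ r) (λ m r′ → g m * k r′)) ∎

  ⋆-assoc : ∀ f g k → (f ⋆ g) ⋆ k ≐ f ⋆ (g ⋆ k)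
  ⋆-assoc = conv-assoc Δ Δ Δ Δ Δ-coassoc

  ≺-⋆-assoc : ∀ f g k → (f ≺ g) ≺ k ≐ f ≺ (g ⋆ k)
  ≺-⋆-assoc = conv-assoc Δ≺ Δ≺ Δ≺ Δ Δ≺-coassoc

  ≻-≺-assoc : ∀ f g k → (f ≻ g) ≺ k ≐ f ≻ (g ≺ k)
  ≻-≺-assoc = conv-assoc Δ≻ Δ≺ Δ≻ Δ≺ Δ≻≺-coassoc

  ⋆-≻-assoc : ∀ f g k → (f ⋆ g) ≻ k ≐ f ≻ (g ≻ k)
  ⋆-≻-assoc = conv-assoc Δ Δ≻ Δ≻ Δ≻ Δ≻-coassoc

  ε-read-letter : ∀ x s → ε (read (just x ∷ s)) ≡ 0#
  ε-read-letter x s with blocks s | blocks-nonempty s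
  ... | _ | g , gs , P.refl = P.refl

  ∑-Δᵇ-εˡ : ∀ t (G : Barred → Carrier) → ∑ (Δᵇ t) (λ p → ε (read (proj₁ p)) * G (proj₂ p)) ≈ G t
  ∑-Δᵇ-εˡ [] G = trans (+-identityʳ _) (*-identityˡ _)
  ∑-Δᵇ-εˡ (nothing ∷ t) G = trans (∑-Δᵇ-bar t _) (∑-Δᵇ-εˡ t (λ z → G (nothing ∷ z)))
  ∑-Δᵇ-εˡ (just x ∷ t) G = begin
    ∑ (Δᵇ (just x ∷ t)) (λ p → ε (read (proj₁ p)) * G (proj₂ p)) ≈⟨ ∑-Δᵇ-letter x t _ ⟩
    ∑ (Δᵇ t) (λ p → ε (read (just x ∷ proj₁ p)) * G (nothing ∷ proj₂ p))
      + ∑ (Δᵇ t) (λ p → ε (read (proj₁ p)) * G (just x ∷ proj₂ p))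
      ≈⟨ +-cong (∑-zero (Δᵇ t) (λ p → trans (*-congʳ (reflexive (ε-read-letter x (proj₁ p)))) (zeroˡ _)))
                (∑-Δᵇ-εˡ t (λ z → G (just x ∷ z))) ⟩
    0# + G (just x ∷ t) ≈⟨ +-identityˡ _ ⟩
    G (just x ∷ t) ∎

  ∑-Δᵇ-εʳ : ∀ t (G : Barred → Carrier) → ∑ (Δᵇ t) (λ p → G (proj₁ p) * ε (read (proj₂ p))) ≈ G t
  ∑-Δᵇ-εʳ [] G = trans (+-identityʳ _) (*-identityʳ _)
  ∑-Δᵇ-εʳ (nothing ∷ t) G = trans (∑-Δᵇ-bar t _) (∑-Δᵇ-εʳ t (λ z → G (nothing ∷ z)))
  ∑-Δᵇ-εʳ (just x ∷ t) G = begin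
    ∑ (Δᵇ (just x ∷ t)) (λ p → G (proj₁ p) * ε (read (proj₂ p))) ≈⟨ ∑-Δᵇ-letter x t _ ⟩
    ∑ (Δᵇ t) (λ p → G (just x ∷ proj₁ p) * ε (read (nothing ∷ proj₂ p)))
      + ∑ (Δᵇ t) (λ p → G (proj₁ p) * ε (read (just x ∷ proj₂ p)))
      ≈⟨ +-cong (∑-Δᵇ-εʳ t (λ z → G (just x ∷ z)))
                (∑-zero (Δᵇ t) (λ p → trans (*-congˡ (reflexive (ε-read-letter x (proj₂ p)))) (zeroʳ _))) ⟩
    G (just x ∷ t) + 0# ≈⟨ +-identityʳ _ ⟩
    G (just x ∷ t) ∎

  ⋆-identityˡ : ∀ f → ε ⋆ f ≐ f
  ⋆-identityˡ f h = trans (∑-Δ-encode h (λ l r → ε l * f r))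
                          (trans (∑-Δᵇ-εˡ (encode h) (λ z → f (read z))) (reflexive (P.cong f (read-encode h))))

  ⋆-identityʳ : ∀ f → f ⋆ ε ≐ f
  ⋆-identityʳ f h = trans (∑-Δ-encode h (λ l r → f l * ε r))
                          (trans (∑-Δᵇ-εʳ (encode h) (λ z → f (read z))) (reflexive (P.cong f (read-encode h))))

  ≻-identityˡ : ∀ f x xs ws → (ε ≻ f) ((x ∷ xs) ∷ ws) ≈ f ((x ∷ xs) ∷ ws)
  ≻-identityˡ f x xs ws = trans (∑-Δ≻-encode x xs ws (λ l r → ε l * f r))
                   (trans (∑-Δᵇ-εˡ (encodeTail xs ws) (λ z → f (read (just x ∷ z)))) (reflexive (P.cong f (read-encode ((x ∷ xs) ∷ ws)))))

  ≺-identityʳ : ∀ f x xs ws → (f ≺ ε) ((x ∷ xs) ∷ ws) ≈ f ((x ∷ xs) ∷ ws)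
  ≺-identityʳ f x xs ws = trans (∑-Δ≺-encode x xs ws (λ l r → f l * ε r))
                   (trans (∑-Δᵇ-εʳ (encodeTail xs ws) (λ z → f (read (just x ∷ z)))) (reflexive (P.cong f (read-encode ((x ∷ xs) ∷ ws)))))

  ε≺≈0 : ∀ f h → (ε ≺ f) h ≈ 0#
  ε≺≈0 f [] = refl
  ε≺≈0 f ((x ∷ xs) ∷ ws) = trans (∑-Δ≺-encode x xs ws (λ l r → ε l * f r))
     (∑-zero (Δᵇ (encodeTail xs ws)) (λ p → trans (*-congʳ (reflexive (ε-read-letter x (proj₁ p)))) (zeroˡ _)))

  ≻ε≈0 : ∀ f h → (f ≻ ε) h ≈ 0#
  ≻ε≈0 f [] = refl
  ≻ε≈0 f ((x ∷ xs) ∷ ws) = trans (∑-Δ≻-encode x xs ws (λ l r → f l * ε r))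
     (∑-zero (Δᵇ (encodeTail xs ws)) (λ p → trans (*-congˡ (reflexive (ε-read-letter x (proj₂ p)))) (zeroʳ _)))

  ⋆≈≺+≻ : ∀ f g x xs ws → (f ⋆ g) ((x ∷ xs) ∷ ws) ≈ (f ≺ g) ((x ∷ xs) ∷ ws) + (f ≻ g) ((x ∷ xs) ∷ ws)
  ⋆≈≺+≻ f g x xs ws = begin
    (f ⋆ g) h ≈⟨ ∑-Δ-encode h (λ l r → f l * g r) ⟩
    ∑ (Δᵇ (just x ∷ encodeTail xs ws)) (λ p → f (read (proj₁ p)) * g (read (proj₂ p))) ≈⟨ ∑-Δᵇ-letter x (encodeTail xs ws) _ ⟩
    ∑ (Δᵇ (encodeTail xs ws)) (λ p → f (read (just x ∷ proj₁ p)) * g (read (proj₂ p)))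
      + ∑ (Δᵇ (encodeTail xs ws)) (λ p → f (read (proj₁ p)) * g (read (just x ∷ proj₂ p)))
      ≈⟨ +-cong (sym (∑-Δ≺-encode x xs ws (λ l r → f l * g r))) (sym (∑-Δ≻-encode x xs ws (λ l r → f l * g r))) ⟩
    (f ≺ g) h + (f ≻ g) h ∎
    where
    h : H
    h = (x ∷ xs) ∷ ws

  module _ (D : H → List (H × H)) where
    conv-cong : ∀ {f f' g g'} → f ≐ f' → g ≐ g' → conv D f g ≐ conv D f' g'
    conv-cong ef eg h = ∑-cong (D h) (λ p → *-cong (ef (proj₁ p)) (eg (proj₂ p)))

    conv-⊕ˡ : ∀ f g k → conv D (f ⊕ g) k ≐ conv D f k ⊕ conv D g k
    conv-⊕ˡ f g k h = trans (∑-cong (D h) (λ p → distribʳ _ _ _)) (∑-+ (D h) _ _)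

    conv-⊕ʳ : ∀ f g k → conv D k (f ⊕ g) ≐ conv D k f ⊕ conv D k g
    conv-⊕ʳ f g k h = trans (∑-cong (D h) (λ p → distribˡ _ _ _)) (∑-+ (D h) _ _)

  #letters : Barred → ℕ
  #letters []            = 0
  #letters (nothing ∷ s) = #letters s
  #letters (just x ∷ s)  = suc (#letters s)

  deg-toH-++ : ∀ g r → deg (toH g ++ r) ≡ length g +ℕ deg r
  deg-toH-++ []       r = P.refl
  deg-toH-++ (y ∷ ys) r = P.refl

  deg-read-letter : ∀ x s → deg (read (just x ∷ s)) ≡ suc (deg (read s))
  deg-read-letter x s with blocks s | blocks-nonempty s
  ... | _ | g , gs , P.refl = P.cong suc (P.sym (deg-toH-++ g (concatMap toH gs)))

  deg-read : ∀ s → deg (read s) ≡ #letters s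
  deg-read []            = P.refl
  deg-read (nothing ∷ s) = deg-read s
  deg-read (just x ∷ s)  = P.trans (deg-read-letter x s) (P.cong suc (deg-read s))

  Δᵇ-#letters : ∀ s → All (λ p → #letters (proj₁ p) +ℕ #letters (proj₂ p) ≡ #letters s) (Δᵇ s)
  Δᵇ-#letters []            = P.refl ∷ []
  Δᵇ-#letters (nothing ∷ s) = AllP.map⁺ (Δᵇ-#letters s)
  Δᵇ-#letters (just x ∷ s)  =
    AllP.++⁺ (AllP.map⁺ (All.map (P.cong suc) (Δᵇ-#letters s)))
             (AllP.map⁺ (All.map (λ {p} e → P.trans (NP.+-suc (#letters (proj₁ p)) _) (P.cong suc e)) (Δᵇ-#letters s)))

  #letters-encode : ∀ h → #letters (encode h) ≡ deg h
  #letters-encode h = P.trans (P.sym (deg-read (encode h))) (P.cong deg (read-encode h))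

  #letters-left< : ∀ x xs ws (l r : Barred) → #letters l +ℕ #letters r ≡ #letters (encodeTail xs ws) →
                   deg (read l) < deg ((x ∷ xs) ∷ ws)
  #letters-left< x xs ws l r e =
    P.subst₂ _<_ (P.sym (deg-read l)) (#letters-encode ((x ∷ xs) ∷ ws)) (s≤s (NP.≤-trans (NP.m≤m+n _ (#letters r)) (NP.≤-reflexive e)))

  #letters-right< : ∀ x xs ws (l r : Barred) → #letters l +ℕ #letters r ≡ #letters (encodeTail xs ws) →
                    deg (read r) < deg ((x ∷ xs) ∷ ws)
  #letters-right< x xs ws l r e =
    P.subst₂ _<_ (P.sym (deg-read r)) (#letters-encode ((x ∷ xs) ∷ ws)) (s≤s (NP.≤-trans (NP.m≤n+m _ (#letters l)) (NP.≤-reflexive e)))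

  AgreeBelow : ℕ → Map → Map → Set (a ⊔ ℓ)
  AgreeBelow n X Z = ∀ h → deg h < n → X h ≈ Z h

  ≐-by-degree : ∀ {X Z : Map} → (∀ h → AgreeBelow (deg h) X Z → X h ≈ Z h) → X ≐ Z
  ≐-by-degree {X} {Z} step h = go (deg h) h NP.≤-refl
    where
    go : ∀ n h → deg h ≤ n → X h ≈ Z h
    go zero    h le = step h (λ h′ lt → ⊥-elim (NP.n≮0 (NP.<-≤-trans lt le)))
    go (suc n) h le = step h (λ h′ lt → go n h′ (s≤s⁻¹ (NP.≤-trans lt le)))

  ≺-agreeBelow : ∀ (κ : Map) {X Z : Map} x xs ws → AgreeBelow (deg ((x ∷ xs) ∷ ws)) X Z →
                 (κ ≺ X) ((x ∷ xs) ∷ ws) ≈ (κ ≺ Z) ((x ∷ xs) ∷ ws)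
  ≺-agreeBelow κ {X} {Z} x xs ws below = begin
    (κ ≺ X) ((x ∷ xs) ∷ ws)                                  ≈⟨ ∑-Δ≺-encode x xs ws (λ l r → κ l * X r) ⟩
    ∑₂ (Δᵇ (encodeTail xs ws)) (λ l r → κ (read (just x ∷ l)) * X (read r))
      ≈⟨ ∑-cong-All (All.map (λ {p} e → *-congˡ (below (read (proj₂ p)) (#letters-right< x xs ws (proj₁ p) (proj₂ p) e)))
                             (Δᵇ-#letters (encodeTail xs ws))) ⟩
    ∑₂ (Δᵇ (encodeTail xs ws)) (λ l r → κ (read (just x ∷ l)) * Z (read r)) ≈⟨ sym (∑-Δ≺-encode x xs ws (λ l r → κ l * Z r)) ⟩
    (κ ≺ Z) ((x ∷ xs) ∷ ws)                                  ∎

  ≻-agreeBelow : ∀ (β : Map) {X Z : Map} x xs ws → AgreeBelow (deg ((x ∷ xs) ∷ ws)) X Z →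
                 (X ≻ β) ((x ∷ xs) ∷ ws) ≈ (Z ≻ β) ((x ∷ xs) ∷ ws)
  ≻-agreeBelow β {X} {Z} x xs ws below = begin
    (X ≻ β) ((x ∷ xs) ∷ ws)                                  ≈⟨ ∑-Δ≻-encode x xs ws (λ l r → X l * β r) ⟩
    ∑₂ (Δᵇ (encodeTail xs ws)) (λ l r → X (read l) * β (read (just x ∷ r)))
      ≈⟨ ∑-cong-All (All.map (λ {p} e → *-congʳ (below (read (proj₁ p)) (#letters-left< x xs ws (proj₁ p) (proj₂ p) e)))
                             (Δᵇ-#letters (encodeTail xs ws))) ⟩
    ∑₂ (Δᵇ (encodeTail xs ws)) (λ l r → Z (read l) * β (read (just x ∷ r))) ≈⟨ sym (∑-Δ≻-encode x xs ws (λ l r → Z l * β r)) ⟩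
    (Z ≻ β) ((x ∷ xs) ∷ ws)                                  ∎

  ≺-equation-unique : ∀ (κ Y X Z : Map) → X [] ≈ Z [] →
    (∀ x xs ws → X ((x ∷ xs) ∷ ws) ≈ (κ ≺ X) ((x ∷ xs) ∷ ws) + Y ((x ∷ xs) ∷ ws)) →
    (∀ x xs ws → Z ((x ∷ xs) ∷ ws) ≈ (κ ≺ Z) ((x ∷ xs) ∷ ws) + Y ((x ∷ xs) ∷ ws)) → X ≐ Z
  ≺-equation-unique κ Y X Z X[] eX eZ = ≐-by-degree step
    where
    step : ∀ h → AgreeBelow (deg h) X Z → X h ≈ Z h
    step []              _     = X[]
    step ((x ∷ xs) ∷ ws) below = trans (eX x xs ws) (trans (+-congʳ (≺-agreeBelow κ x xs ws below)) (sym (eZ x xs ws)))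

  ≻-equation-unique : ∀ (β Y X Z : Map) → X [] ≈ Z [] →
    (∀ x xs ws → X ((x ∷ xs) ∷ ws) ≈ (X ≻ β) ((x ∷ xs) ∷ ws) + Y ((x ∷ xs) ∷ ws)) →
    (∀ x xs ws → Z ((x ∷ xs) ∷ ws) ≈ (Z ≻ β) ((x ∷ xs) ∷ ws) + Y ((x ∷ xs) ∷ ws)) → X ≐ Z
  ≻-equation-unique β Y X Z X[] eX eZ = ≐-by-degree step
    where
    step : ∀ h → AgreeBelow (deg h) X Z → X h ≈ Z h
    step []              _     = X[]
    step ((x ∷ xs) ∷ ws) below = trans (eX x xs ws) (trans (+-congʳ (≻-agreeBelow β x xs ws below)) (sym (eZ x xs ws)))

  tangent-≺-solution : ∀ (Φ Φ′ Φinv κ κ′ : Map) → Φ ⋆ Φinv ≐ ε →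
                       (∀ h → Φ h ≈ ε h + (κ ≺ Φ) h) → (∀ h → Φ′ h ≈ (κ ≺ Φ′) h + (κ′ ≺ Φ) h) →
                       Φ′ ≐ Φ ⋆ θ Φinv Φ κ′
  tangent-≺-solution Φ Φ′ Φinv κ κ′ Φ⋆Φinv≈ε hΦ hΦ′ =
    ≺-equation-unique κ (κ′ ≺ Φ) Φ′ (Φ ⋆ ϑ) Φ′[] (λ x xs ws → hΦ′ ((x ∷ xs) ∷ ws)) Z-equation
    where
    ϑ : Map
    ϑ = θ Φinv Φ κ′
    Φ′[] : Φ′ [] ≈ (Φ ⋆ ϑ) []
    Φ′[] = trans (hΦ′ []) (trans (+-identityˡ 0#) (sym (trans (+-identityʳ _) (zeroʳ _))))
    Z-equation : ∀ x xs ws → (Φ ⋆ ϑ) ((x ∷ xs) ∷ ws) ≈ (κ ≺ (Φ ⋆ ϑ)) ((x ∷ xs) ∷ ws) + (κ′ ≺ Φ) ((x ∷ xs) ∷ ws)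
    Z-equation x xs ws = begin
      (Φ ⋆ ϑ) h                                           ≈⟨ ⋆≈≺+≻ Φ ϑ x xs ws ⟩
      (Φ ≺ ϑ) h + (Φ ≻ ϑ) h                               ≈⟨ +-cong (conv-cong Δ≺ hΦ (λ _ → refl) h)
                                                                   (conv-cong Δ≻ (λ _ → refl) (≻-≺-assoc Φinv κ′ Φ) h) ⟩
      ((ε ⊕ (κ ≺ Φ)) ≺ ϑ) h + (Φ ≻ (Φinv ≻ (κ′ ≺ Φ))) h   ≈⟨ +-cong (conv-⊕ˡ Δ≺ ε (κ ≺ Φ) ϑ h) (sym (⋆-≻-assoc Φ Φinv (κ′ ≺ Φ) h)) ⟩
      ((ε ≺ ϑ) h + ((κ ≺ Φ) ≺ ϑ) h) + ((Φ ⋆ Φinv) ≻ (κ′ ≺ Φ)) h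
        ≈⟨ +-cong (+-cong (ε≺≈0 ϑ h) (≺-⋆-assoc κ Φ ϑ h)) (conv-cong Δ≻ Φ⋆Φinv≈ε (λ _ → refl) h) ⟩
      (0# + (κ ≺ (Φ ⋆ ϑ)) h) + (ε ≻ (κ′ ≺ Φ)) h            ≈⟨ +-cong (+-identityˡ _) (≻-identityˡ (κ′ ≺ Φ) x xs ws) ⟩
      (κ ≺ (Φ ⋆ ϑ)) h + (κ′ ≺ Φ) h                        ∎
      where
      h : H
      h = (x ∷ xs) ∷ ws

  tangent-≻-solution : ∀ (Φ Φ′ Φinv β β′ : Map) → Φinv ⋆ Φ ≐ ε →
                       (∀ h → Φ h ≈ ε h + (Φ ≻ β) h) → (∀ h → Φ′ h ≈ (Φ ≻ β′) h + (Φ′ ≻ β) h) →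
                       Φ′ ≐ θ Φ Φinv β′ ⋆ Φ
  tangent-≻-solution Φ Φ′ Φinv β β′ Φinv⋆Φ≈ε hΦ hΦ′ =
    ≻-equation-unique β (Φ ≻ β′) Φ′ (ϑ ⋆ Φ) Φ′[] (λ x xs ws → trans (hΦ′ ((x ∷ xs) ∷ ws)) (+-comm _ _)) Z-equation
    where
    ϑ : Map
    ϑ = θ Φ Φinv β′
    Φ′[] : Φ′ [] ≈ (ϑ ⋆ Φ) []
    Φ′[] = trans (hΦ′ []) (trans (+-identityˡ 0#) (sym (trans (+-identityʳ _) (zeroˡ _))))
    Z-equation : ∀ x xs ws → (ϑ ⋆ Φ) ((x ∷ xs) ∷ ws) ≈ ((ϑ ⋆ Φ) ≻ β) ((x ∷ xs) ∷ ws) + (Φ ≻ β′) ((x ∷ xs) ∷ ws)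
    Z-equation x xs ws = begin
      (ϑ ⋆ Φ) h                                           ≈⟨ ⋆≈≺+≻ ϑ Φ x xs ws ⟩
      (ϑ ≺ Φ) h + (ϑ ≻ Φ) h                               ≈⟨ +-cong (≺-⋆-assoc (Φ ≻ β′) Φinv Φ h) (conv-cong Δ≻ (λ _ → refl) hΦ h) ⟩
      ((Φ ≻ β′) ≺ (Φinv ⋆ Φ)) h + (ϑ ≻ (ε ⊕ (Φ ≻ β))) h   ≈⟨ +-cong (conv-cong Δ≺ (λ _ → refl) Φinv⋆Φ≈ε h) (conv-⊕ʳ Δ≻ ε (Φ ≻ β) ϑ h) ⟩
      ((Φ ≻ β′) ≺ ε) h + ((ϑ ≻ ε) h + (ϑ ≻ (Φ ≻ β)) h)
        ≈⟨ +-cong (≺-identityʳ (Φ ≻ β′) x xs ws) (+-cong (≻ε≈0 ϑ h) (sym (⋆-≻-assoc ϑ Φ β h))) ⟩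
      (Φ ≻ β′) h + (0# + ((ϑ ⋆ Φ) ≻ β) h)                 ≈⟨ trans (+-congˡ (+-identityˡ _)) (+-comm _ _) ⟩
      ((ϑ ⋆ Φ) ≻ β) h + (Φ ≻ β′) h                        ∎
      where
      h : H
      h = (x ∷ xs) ∷ ws

  scale : Carrier → Map → Map
  scale k f h = k * f h

  record IsLinear (op : Map → Map) : Set (a ⊔ c ⊔ ℓ) where
    field
      lin-cong  : ∀ {f g} → f ≐ g → op f ≐ op g
      lin-⊕     : ∀ f g → op (f ⊕ g) ≐ op f ⊕ op g
      lin-scale : ∀ k f → op (scale k f) ≐ scale k (op f)

    lin-zero : ∀ f → (∀ h → f h ≈ 0#) → ∀ h → op f h ≈ 0#
    lin-zero f z h = begin
      op f h             ≈⟨ lin-cong (λ h′ → trans (z h′) (sym (zeroˡ (f h′)))) h ⟩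
      op (scale 0# f) h  ≈⟨ lin-scale 0# f h ⟩
      0# * op f h        ≈⟨ zeroˡ _ ⟩
      0#                 ∎

    lin-⊖ : ∀ f g → op (f ⊖ g) ≐ op f ⊖ op g
    lin-⊖ f g h = begin
      op (f ⊖ g) h                  ≈⟨ lin-⊕ f (λ h → - g h) h ⟩
      op f h + op (λ h → - g h) h   ≈⟨ +-congˡ (lin-cong (λ h′ → sym (-1*x≈-x (g h′))) h) ⟩
      op f h + op (scale (- 1#) g) h ≈⟨ +-congˡ (trans (lin-scale (- 1#) g h) (-1*x≈-x _)) ⟩
      op f h + - op g h             ∎

    lin-∑ : ∀ {b} {X : Set b} (xs : List X) (F : X → Map) → op (λ h → ∑ xs (λ i → F i h)) ≐ λ h → ∑ xs (λ i → op (F i) h)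
    lin-∑ []       F h = lin-zero _ (λ _ → refl) h
    lin-∑ (i ∷ xs) F h = trans (lin-⊕ (F i) (λ h → ∑ xs (λ i → F i h)) h) (+-congˡ (lin-∑ xs F h))

    lin-∑-scale : ∀ {b} {X : Set b} (xs : List X) (c : X → Carrier) (F : X → Map) →
                  op (λ h → ∑ xs (λ i → c i * F i h)) ≐ λ h → ∑ xs (λ i → c i * op (F i) h)
    lin-∑-scale xs c F h = trans (lin-∑ xs (λ i → scale (c i) (F i)) h) (∑-cong xs (λ i → lin-scale (c i) (F i) h))
  open IsLinear

  conv-linearʳ : ∀ D k → IsLinear (conv D k)
  conv-linearʳ D k = record
    { lin-cong  = conv-cong D (λ _ → refl)
    ; lin-⊕     = λ f g → conv-⊕ʳ D f g k
    ; lin-scale = λ d f h → trans (∑-cong (D h) (λ _ → x*yz≈y*xz _ _ _)) (sym (*-distribˡ-∑ d (D h) _))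
    }

  conv-linearˡ : ∀ D k → IsLinear (λ y → conv D y k)
  conv-linearˡ D k = record
    { lin-cong  = λ e → conv-cong D e (λ _ → refl)
    ; lin-⊕     = λ f g → conv-⊕ˡ D f g k
    ; lin-scale = λ d f h → trans (∑-cong (D h) (λ _ → *-assoc _ _ _)) (sym (*-distribˡ-∑ d (D h) _))
    }

  ⊖-linear : ∀ {op₁ op₂} → IsLinear op₁ → IsLinear op₂ → IsLinear (λ y → op₁ y ⊖ op₂ y)
  ⊖-linear {op₁} {op₂} L₁ L₂ = record
    { lin-cong  = λ e h → +-cong (lin-cong L₁ e h) (-‿cong (lin-cong L₂ e h))
    ; lin-⊕     = λ f g h → begin
        op₁ (f ⊕ g) h + - op₂ (f ⊕ g) h                ≈⟨ +-cong (lin-⊕ L₁ f g h) (-‿cong (lin-⊕ L₂ f g h)) ⟩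
        (op₁ f h + op₁ g h) + - (op₂ f h + op₂ g h)     ≈⟨ +-congˡ (sym (-‿+-comm _ _)) ⟩
        (op₁ f h + op₁ g h) + (- op₂ f h + - op₂ g h)   ≈⟨ interchange _ _ _ _ ⟩
        (op₁ f h + - op₂ f h) + (op₁ g h + - op₂ g h)   ∎
    ; lin-scale = λ d f h → begin
        op₁ (scale d f) h + - op₂ (scale d f) h        ≈⟨ +-cong (lin-scale L₁ d f h) (-‿cong (lin-scale L₂ d f h)) ⟩
        d * op₁ f h + - (d * op₂ f h)                  ≈⟨ +-congˡ (-‿distribʳ-* _ _) ⟩
        d * op₁ f h + d * - op₂ f h                    ≈⟨ sym (distribˡ _ _ _) ⟩
        d * (op₁ f h + - op₂ f h)                      ∎
    }

  Ord≥ : ℕ → Map → Set (a ⊔ ℓ)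
  Ord≥ k f = ∀ h → deg h < k → f h ≈ 0#

  Ord≥-mono : ∀ {j k f} → j ≤ k → Ord≥ k f → Ord≥ j f
  Ord≥-mono j≤k f≥k h lt = f≥k h (NP.<-≤-trans lt j≤k)

  Ord≥-0 : ∀ f → Ord≥ 0 f
  Ord≥-0 f h ()

  Ord≥-1 : ∀ f → f [] ≈ 0# → Ord≥ 1 f
  Ord≥-1 f f[] []               _         = f[]
  Ord≥-1 f f[] ((y ∷ ys) ∷ ws) (s≤s ())

  Ord≥-⊕ : ∀ {k f g} → Ord≥ k f → Ord≥ k g → Ord≥ k (f ⊕ g)
  Ord≥-⊕ f≥k g≥k h lt = trans (+-cong (f≥k h lt) (g≥k h lt)) (+-identityˡ _)

  Ord≥-⊖ : ∀ {k f g} → Ord≥ k f → Ord≥ k g → Ord≥ k (f ⊖ g)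
  Ord≥-⊖ f≥k g≥k h lt = trans (+-cong (f≥k h lt) (trans (-‿cong (g≥k h lt)) -0#≈0#)) (+-identityˡ _)

  -- Each term of (f ⋆ g) h splits the letters of h, so it has fewer than i letters on the left or fewer than j on the right.
  Ord≥-⋆ : ∀ {i j f g} → Ord≥ i f → Ord≥ j g → Ord≥ (i +ℕ j) (f ⋆ g)
  Ord≥-⋆ {i} {j} {f} {g} f≥i g≥j h lt =
    trans (∑-Δ-encode h (λ l r → f l * g r)) (∑-zero-All (All.map (λ {p} e → term≈0 p e) (Δᵇ-#letters (encode h))))
    where
    term≈0 : ∀ p → #letters (proj₁ p) +ℕ #letters (proj₂ p) ≡ #letters (encode h) → f (read (proj₁ p)) * g (read (proj₂ p)) ≈ 0#
    term≈0 (l , r) e with #letters l <? i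
    ... | yes l<i = trans (*-congʳ (f≥i (read l) (P.subst (_< i) (P.sym (deg-read l)) l<i))) (zeroˡ _)
    ... | no  l≮i = trans (*-congˡ (g≥j (read r) (P.subst (_< j) (P.sym (deg-read r)) r<j))) (zeroʳ _)
      where
      l+r<i+j : #letters l +ℕ #letters r < i +ℕ j
      l+r<i+j = P.subst (_< i +ℕ j) (P.trans (P.sym (#letters-encode h)) (P.sym e)) lt
      r<j : #letters r < j
      r<j = NP.+-cancelˡ-< i (#letters r) j (NP.≤-<-trans (NP.+-monoˡ-≤ (#letters r) (NP.≮⇒≥ l≮i)) l+r<i+j)

  ⋆-cong-below : ∀ {f f′ g g′ : Map} h → (∀ l → deg l ≤ deg h → f l ≈ f′ l) → (∀ r → deg r ≤ deg h → g r ≈ g′ r) →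
                 (f ⋆ g) h ≈ (f′ ⋆ g′) h
  ⋆-cong-below {f} {f′} {g} {g′} h f≈f′ g≈g′ = begin
    (f ⋆ g) h                                              ≈⟨ ∑-Δ-encode h (λ l r → f l * g r) ⟩
    ∑₂ (Δᵇ (encode h)) (λ l r → f (read l) * g (read r))
      ≈⟨ ∑-cong-All (All.map (λ {p} e → *-cong (f≈f′ _ (left≤ p e)) (g≈g′ _ (right≤ p e))) (Δᵇ-#letters (encode h))) ⟩
    ∑₂ (Δᵇ (encode h)) (λ l r → f′ (read l) * g′ (read r))  ≈⟨ sym (∑-Δ-encode h (λ l r → f′ l * g′ r)) ⟩
    (f′ ⋆ g′) h                                            ∎
    where
    left≤ : ∀ p → #letters (proj₁ p) +ℕ #letters (proj₂ p) ≡ #letters (encode h) → deg (read (proj₁ p)) ≤ deg h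
    left≤ (l , r) e = P.subst₂ _≤_ (P.sym (deg-read l)) (P.trans e (#letters-encode h)) (NP.m≤m+n _ _)
    right≤ : ∀ p → #letters (proj₁ p) +ℕ #letters (proj₂ p) ≡ #letters (encode h) → deg (read (proj₂ p)) ≤ deg h
    right≤ (l , r) e = P.subst₂ _≤_ (P.sym (deg-read r)) (P.trans e (#letters-encode h)) (NP.m≤n+m _ _)

  negPow≈sign* : ∀ m v → negPow m v ≈ sign m * v
  negPow≈sign* zero    v = sym (*-identityˡ v)
  negPow≈sign* (suc m) v = begin
    - negPow m v         ≈⟨ -‿cong (negPow≈sign* m v) ⟩
    - (sign m * v)       ≈⟨ sym (-1*x≈-x _) ⟩
    - 1# * (sign m * v)  ≈⟨ sym (*-assoc _ _ _) ⟩
    (- 1# * sign m) * v  ∎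

  module Powers (r x : Map) where

    leftPow : ℕ → Map → Map
    leftPow zero    y = y
    leftPow (suc p) y = r ⋆ leftPow p y

    rightPow : ℕ → Map → Map
    rightPow zero    y = y
    rightPow (suc q) y = rightPow q y ⋆ r

    adPow : ℕ → Map
    adPow m = AdN m r x

    powAd : ℕ → ℕ → Map
    powAd a m = leftPow a (adPow m)

    -- The ħ-coefficient of (r + ħ x)^⋆n.
    tangentPow : ℕ → Map
    tangentPow zero    = λ _ → 0#
    tangentPow (suc n) = (r ⋆ tangentPow n) ⊕ (x ⋆ pow n r)

    sandwich : ℕ → Map
    sandwich k h = ∑ᵃ k (λ p q → leftPow p (rightPow q x) h)

    r⋆-linear : IsLinear (r ⋆_)
    r⋆-linear = conv-linearʳ Δ r

    ⋆r-linear : IsLinear (_⋆ r)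
    ⋆r-linear = conv-linearˡ Δ r

    Ad-linear : IsLinear (Ad r)
    Ad-linear = ⊖-linear r⋆-linear ⋆r-linear

    pow⋆≈leftPow : ∀ n y → pow n r ⋆ y ≐ leftPow n y
    pow⋆≈leftPow zero    y   = ⋆-identityˡ y
    pow⋆≈leftPow (suc n) y h = trans (⋆-assoc r (pow n r) y h) (lin-cong r⋆-linear (pow⋆≈leftPow n y) h)

    pow⋆r≈r⋆pow : ∀ n → pow n r ⋆ r ≐ r ⋆ pow n r
    pow⋆r≈r⋆pow zero    h = trans (⋆-identityˡ r h) (sym (⋆-identityʳ r h))
    pow⋆r≈r⋆pow (suc n) h = trans (⋆-assoc r (pow n r) r h) (lin-cong r⋆-linear (pow⋆r≈r⋆pow n) h)

    ⋆pow≈rightPow : ∀ n y → y ⋆ pow n r ≐ rightPow n y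
    ⋆pow≈rightPow zero    y   = ⋆-identityʳ y
    ⋆pow≈rightPow (suc n) y h = begin
      (y ⋆ (r ⋆ pow n r)) h  ≈⟨ lin-cong (conv-linearʳ Δ y) (λ h′ → sym (pow⋆r≈r⋆pow n h′)) h ⟩
      (y ⋆ (pow n r ⋆ r)) h  ≈⟨ sym (⋆-assoc y (pow n r) r h) ⟩
      ((y ⋆ pow n r) ⋆ r) h  ≈⟨ lin-cong ⋆r-linear (⋆pow≈rightPow n y) h ⟩
      (rightPow n y ⋆ r) h   ∎

    sandwich-suc : ∀ k h → (r ⋆ sandwich k) h + rightPow (suc k) x h ≈ sandwich (suc k) h
    sandwich-suc k h = begin
      (r ⋆ sandwich k) h + rightPow (suc k) x h
        ≈⟨ +-congʳ (lin-∑ r⋆-linear (antidiagonal k) (λ pq → leftPow (proj₁ pq) (rightPow (proj₂ pq) x)) h) ⟩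
      ∑ᵃ k (λ p q → leftPow (suc p) (rightPow q x) h) + rightPow (suc k) x h
        ≈⟨ +-comm _ _ ⟩
      rightPow (suc k) x h + ∑ᵃ k (λ p q → leftPow (suc p) (rightPow q x) h)
        ≈⟨ sym (∑ᵃ-suc k (λ p q → leftPow p (rightPow q x) h)) ⟩
      sandwich (suc k) h ∎

    tangentPow≈sandwich : ∀ k → tangentPow (suc k) ≐ sandwich k
    tangentPow≈sandwich zero    h = begin
      (r ⋆ tangentPow 0) h + (x ⋆ ε) h  ≈⟨ +-cong (lin-zero r⋆-linear _ (λ _ → refl) h) (⋆-identityʳ x h) ⟩
      0# + x h                          ≈⟨ +-comm _ _ ⟩
      x h + 0#                          ∎
    tangentPow≈sandwich (suc k) h = begin
      (r ⋆ tangentPow (suc k)) h + (x ⋆ pow (suc k) r) h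
        ≈⟨ +-cong (lin-cong r⋆-linear (tangentPow≈sandwich k) h) (⋆pow≈rightPow (suc k) x h) ⟩
      (r ⋆ sandwich k) h + rightPow (suc k) x h
        ≈⟨ sandwich-suc k h ⟩
      sandwich (suc k) h ∎

    leftPow-Ad-comm : ∀ p y → leftPow p (Ad r y) ≐ Ad r (leftPow p y)
    leftPow-Ad-comm zero    y h = refl
    leftPow-Ad-comm (suc p) y h = begin
      (r ⋆ leftPow p (Ad r y)) h                       ≈⟨ lin-cong r⋆-linear (leftPow-Ad-comm p y) h ⟩
      (r ⋆ Ad r (leftPow p y)) h                       ≈⟨ lin-⊖ r⋆-linear (r ⋆ leftPow p y) (leftPow p y ⋆ r) h ⟩
      (r ⋆ (r ⋆ leftPow p y)) h + - (r ⋆ (leftPow p y ⋆ r)) h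
        ≈⟨ +-congˡ (-‿cong (sym (⋆-assoc r (leftPow p y) r h))) ⟩
      Ad r (leftPow (suc p) y) h                       ∎

    powAd-suc : ∀ a m → powAd a (suc m) ≐ Ad r (powAd a m)
    powAd-suc a m = leftPow-Ad-comm a (adPow m)

    module Series (inv : ℕ → Carrier) (inv-spec : ∀ n → ⌜ suc n ⌝ * inv n ≈ 1#) where
      open InvFact inv inv-spec

      ∑ᵃ-powAd : (ℕ → ℕ → Carrier) → ℕ → Map
      ∑ᵃ-powAd κ n h = ∑ᵃ n (λ a m → κ a m * powAd a m h)

      ∑ᵃ-leftWeight : ∀ κ → (∀ a m → ⌜ suc a ⌝ * κ (suc a) m ≈ κ a m) → ∀ n h →
                      ∑ᵃ (suc n) (λ a m → ⌜ a ⌝ * (κ a m * powAd a m h)) ≈ (r ⋆ ∑ᵃ-powAd κ n) h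
      ∑ᵃ-leftWeight κ κ-suc n h = begin
        ∑ᵃ (suc n) (λ a m → ⌜ a ⌝ * (κ a m * powAd a m h))
          ≈⟨ ∑ᵃ-suc n _ ⟩
        0# * (κ 0 (suc n) * powAd 0 (suc n) h) + ∑ᵃ n (λ a m → ⌜ suc a ⌝ * (κ (suc a) m * (r ⋆ powAd a m) h))
          ≈⟨ trans (+-congʳ (zeroˡ _)) (+-identityˡ _) ⟩
        ∑ᵃ n (λ a m → ⌜ suc a ⌝ * (κ (suc a) m * (r ⋆ powAd a m) h))
          ≈⟨ ∑ᵃ-cong n (λ a m → trans (sym (*-assoc _ _ _)) (*-congʳ (κ-suc a m))) ⟩
        ∑ᵃ n (λ a m → κ a m * (r ⋆ powAd a m) h)
          ≈⟨ sym (lin-∑-scale r⋆-linear (antidiagonal n) (λ am → κ (proj₁ am) (proj₂ am)) (λ am → powAd (proj₁ am) (proj₂ am)) h) ⟩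
        (r ⋆ ∑ᵃ-powAd κ n) h ∎

      ∑ᵃ-rightWeight : ∀ n h → ∑ᵃ (suc n) (λ a m → ⌜ m ⌝ * (cV a m * powAd a m h)) ≈ - 1# * Ad r (∑ᵃ-powAd cV n) h
      ∑ᵃ-rightWeight n h = begin
        ∑ᵃ (suc n) (λ a m → ⌜ m ⌝ * (cV a m * powAd a m h))
          ≈⟨ ∑ᵃ-sucʳ n _ ⟩
        0# * (cV (suc n) 0 * powAd (suc n) 0 h) + ∑ᵃ n (λ a m → ⌜ suc m ⌝ * (cV a (suc m) * powAd a (suc m) h))
          ≈⟨ trans (+-congʳ (zeroˡ _)) (+-identityˡ _) ⟩
        ∑ᵃ n (λ a m → ⌜ suc m ⌝ * (cV a (suc m) * powAd a (suc m) h))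
          ≈⟨ ∑ᵃ-cong n (λ a m → trans (sym (*-assoc _ _ _)) (trans (*-cong (cV-sucʳ a m) (powAd-suc a m h)) (*-assoc _ _ _))) ⟩
        ∑ᵃ n (λ a m → - 1# * (cV a m * Ad r (powAd a m) h))
          ≈⟨ sym (*-distribˡ-∑ (- 1#) (antidiagonal n) _) ⟩
        - 1# * ∑ᵃ n (λ a m → cV a m * Ad r (powAd a m) h)
          ≈⟨ *-congˡ (sym (lin-∑-scale Ad-linear (antidiagonal n) (λ am → cV (proj₁ am) (proj₂ am))
                                                                  (λ am → powAd (proj₁ am) (proj₂ am)) h)) ⟩
        - 1# * Ad r (∑ᵃ-powAd cV n) h ∎

      -- The degree-n part of e^r ⋆ e^(-ad r)(x) = x ⋆ e^r.
      ∑ᵃ-powAd-cV : ∀ n → ∑ᵃ-powAd cV n ≐ scale (invFact n) (rightPow n x)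
      ∑ᵃ-powAd-cV zero    h = trans (+-identityʳ _) (*-congʳ (trans (*-identityˡ _) (*-identityˡ _)))
      ∑ᵃ-powAd-cV (suc n) h = ⌜suc⌝*-cancel n (begin
        ⌜ suc n ⌝ * ∑ᵃ-powAd cV (suc n) h
          ≈⟨ ⌜⌝*∑ᵃ 0 (suc n) _ ⟩
        ∑ᵃ (suc n) (λ a m → ⌜ a ⌝ * (cV a m * powAd a m h)) + ∑ᵃ (suc n) (λ a m → ⌜ m ⌝ * (cV a m * powAd a m h))
          ≈⟨ +-cong (∑ᵃ-leftWeight cV cV-sucˡ n h) (∑ᵃ-rightWeight n h) ⟩
        (r ⋆ V) h + - 1# * Ad r V h                                ≈⟨ u+-1*[u-w]≈w _ _ ⟩
        (V ⋆ r) h                                                  ≈⟨ lin-cong ⋆r-linear (∑ᵃ-powAd-cV n) h ⟩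
        (scale (invFact n) (rightPow n x) ⋆ r) h                   ≈⟨ lin-scale ⋆r-linear (invFact n) (rightPow n x) h ⟩
        invFact n * rightPow (suc n) x h                           ≈⟨ invFact*≈⌜suc⌝*invFact-suc* n _ ⟩
        ⌜ suc n ⌝ * (invFact (suc n) * rightPow (suc n) x h)       ∎)
        where
        V : Map
        V = ∑ᵃ-powAd cV n

      ∑ᵃ-powAd-cP : ∀ k → ∑ᵃ-powAd cP k ≐ scale (invFact (suc k)) (sandwich k)
      ∑ᵃ-powAd-cP zero    h =
        trans (+-identityʳ _) (trans (*-congʳ (trans (*-identityˡ _) (*-identityˡ _))) (*-congˡ (sym (+-identityʳ _))))
      ∑ᵃ-powAd-cP (suc k) h = ⌜suc⌝*-cancel (suc k) (begin
        ⌜ suc (suc k) ⌝ * ∑ᵃ-powAd cP (suc k) h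
          ≈⟨ ⌜⌝*∑ᵃ 1 (suc k) _ ⟩
        ∑ᵃ (suc k) (λ a m → ⌜ a ⌝ * (cP a m * powAd a m h)) + ∑ᵃ (suc k) (λ a m → ⌜ suc m ⌝ * (cP a m * powAd a m h))
          ≈⟨ +-cong (∑ᵃ-leftWeight cP cP-sucˡ k h) (∑ᵃ-cong (suc k) (λ a m → trans (sym (*-assoc _ _ _)) (*-congʳ (cP-weight a m)))) ⟩
        (r ⋆ ∑ᵃ-powAd cP k) h + ∑ᵃ-powAd cV (suc k) h
          ≈⟨ +-cong (trans (lin-cong r⋆-linear (∑ᵃ-powAd-cP k) h) (lin-scale r⋆-linear _ (sandwich k) h)) (∑ᵃ-powAd-cV (suc k) h) ⟩
        invFact (suc k) * (r ⋆ sandwich k) h + invFact (suc k) * rightPow (suc k) x h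
          ≈⟨ sym (distribˡ _ _ _) ⟩
        invFact (suc k) * ((r ⋆ sandwich k) h + rightPow (suc k) x h)
          ≈⟨ *-congˡ (sandwich-suc k h) ⟩
        invFact (suc k) * sandwich (suc k) h
          ≈⟨ invFact*≈⌜suc⌝*invFact-suc* (suc k) _ ⟩
        ⌜ suc (suc k) ⌝ * (invFact (suc (suc k)) * sandwich (suc k) h) ∎)

  module Orders (r x : Map) (r[] : r [] ≈ 0#) (x[] : x [] ≈ 0#) where
    open Powers r x

    Ord≥-r : Ord≥ 1 r
    Ord≥-r = Ord≥-1 r r[]

    Ord≥-pow : ∀ n → Ord≥ n (pow n r)
    Ord≥-pow zero    = Ord≥-0 _
    Ord≥-pow (suc n) = Ord≥-⋆ Ord≥-r (Ord≥-pow n)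

    Ord≥-tangentPow : ∀ n → Ord≥ n (tangentPow n)
    Ord≥-tangentPow zero    = Ord≥-0 _
    Ord≥-tangentPow (suc n) = Ord≥-⊕ (Ord≥-⋆ Ord≥-r (Ord≥-tangentPow n)) (Ord≥-⋆ (Ord≥-1 x x[]) (Ord≥-pow n))

    Ord≥-Ad : ∀ {k y} → Ord≥ k y → Ord≥ (suc k) (Ad r y)
    Ord≥-Ad {k} y≥k = Ord≥-⊖ (Ord≥-⋆ Ord≥-r y≥k) (Ord≥-mono (NP.≤-reflexive (NP.+-comm 1 k)) (Ord≥-⋆ y≥k Ord≥-r))

    Ord≥-adPow : ∀ m → Ord≥ (suc m) (adPow m)
    Ord≥-adPow zero    = Ord≥-1 x x[]
    Ord≥-adPow (suc m) = Ord≥-Ad (Ord≥-adPow m)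

    Ord≥-leftPow : ∀ p {k y} → Ord≥ k y → Ord≥ (p +ℕ k) (leftPow p y)
    Ord≥-leftPow zero    y≥k = y≥k
    Ord≥-leftPow (suc p) y≥k = Ord≥-⋆ Ord≥-r (Ord≥-leftPow p y≥k)

    Ord≥-powAd : ∀ a m → Ord≥ (a +ℕ suc m) (powAd a m)
    Ord≥-powAd a m = Ord≥-leftPow a (Ord≥-adPow m)

  module ExpTangent (inv : ℕ → Carrier) (inv-spec : ∀ n → ⌜ suc n ⌝ * inv n ≈ 1#)
                    (r x : Map) (r[] : r [] ≈ 0#) (x[] : x [] ≈ 0#) where
    open InvFact inv inv-spec
    open Powers r x
    open Series inv inv-spec
    open Orders r x r[] x[]

    expTrunc : ℕ → Map
    expTrunc M l = ∑< M (λ n → invFact n * pow n r l)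

    WTerm : ℕ → Map
    WTerm m y = negPow m (invFact (suc m) * adPow m y)

    WTrunc : ℕ → Map
    WTrunc M y = ∑< M (λ m → WTerm m y)

    exp≈expTrunc : ∀ M l → deg l < M → ∑< (suc (deg l)) (λ n → invFact n * pow n r l) ≈ expTrunc M l
    exp≈expTrunc M l l<M = sym (∑<-truncate (suc (deg l)) M _ l<M (λ n l<n → trans (*-congˡ (Ord≥-pow n l l<n)) (zeroʳ _)))

    W≈WTrunc : ∀ M y → deg y < M → W invFact r x y ≈ WTrunc M y
    W≈WTrunc M y y<M = begin
      x y + ∑< (deg y) (λ n → WTerm (suc n) y)           ≈⟨ +-congʳ (sym (trans (*-congʳ invFact-1) (*-identityˡ _))) ⟩
      WTerm 0 y + ∑< (deg y) (λ n → WTerm (suc n) y)     ≈⟨ sym (∑<-suc (deg y) (λ m → WTerm m y)) ⟩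
      ∑< (suc (deg y)) (λ m → WTerm m y)                 ≈⟨ sym (∑<-truncate (suc (deg y)) M _ y<M vanish) ⟩
      WTrunc M y                                         ∎
      where
      vanish : ∀ m → suc (deg y) ≤ m → WTerm m y ≈ 0#
      vanish m y<m = trans (negPow≈sign* m _)
        (trans (*-congˡ (trans (*-congˡ (Ord≥-adPow m y (NP.m<n⇒m<1+n y<m))) (zeroʳ _))) (zeroʳ _))

    ∑-Δ-term : ∀ a m h → ∑₂ (Δ h) (λ l y → (invFact a * pow a r l) * WTerm m y) ≈ cP a m * powAd a m h
    ∑-Δ-term a m h = begin
      ∑₂ (Δ h) (λ l y → (invFact a * pow a r l) * WTerm m y)
        ≈⟨ ∑-cong (Δ h) (λ p → trans (*-congˡ (negPow≈sign* m _)) (cP-product a m _ _)) ⟩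
      ∑₂ (Δ h) (λ l y → cP a m * (pow a r l * adPow m y))  ≈⟨ sym (*-distribˡ-∑ (cP a m) (Δ h) _) ⟩
      cP a m * (pow a r ⋆ adPow m) h                       ≈⟨ *-congˡ (pow⋆≈leftPow a (adPow m) h) ⟩
      cP a m * powAd a m h                                 ∎

    tangent-series≈∑∑cP : ∀ h → let M = suc (deg h) in
      ∑< M (λ n → invFact n * tangentPow n h) ≈ ∑< M (λ a → ∑< M (λ m → cP a m * powAd a m h))
    tangent-series≈∑∑cP h = begin
      ∑< M (λ n → invFact n * tangentPow n h)
        ≈⟨ ∑<-suc N _ ⟩
      invFact 0 * 0# + ∑< N (λ k → invFact (suc k) * tangentPow (suc k) h)
        ≈⟨ +-cong (zeroʳ _) (∑<-cong N (λ k → trans (*-congˡ (tangentPow≈sandwich k h)) (sym (∑ᵃ-powAd-cP k h)))) ⟩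
      0# + ∑< N (λ k → ∑ᵃ-powAd cP k h)
        ≈⟨ +-identityˡ _ ⟩
      ∑< N (λ k → ∑ᵃ-powAd cP k h)
        ≈⟨ sym (∑<-truncate N M _ (NP.n≤1+n N) vanish) ⟩
      ∑< M (λ k → ∑ᵃ-powAd cP k h)
        ≈⟨ sym (∑<-∑<-by-antidiagonals M M M _ NP.≤-refl NP.≤-refl outside) ⟩
      ∑< M (λ a → ∑< M (λ m → cP a m * powAd a m h)) ∎
      where
      N : ℕ
      N = deg h
      M : ℕ
      M = suc N
      vanish : ∀ k → N ≤ k → ∑ᵃ-powAd cP k h ≈ 0#
      vanish k N≤k = trans (∑ᵃ-powAd-cP k h)
        (trans (*-congˡ (sym (tangentPow≈sandwich k h))) (trans (*-congˡ (Ord≥-tangentPow (suc k) h (s≤s N≤k))) (zeroʳ _)))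
      outside : ∀ a m → M ≤ a +ℕ m → cP a m * powAd a m h ≈ 0#
      outside a m M≤a+m = trans (*-congˡ (Ord≥-powAd a m h (NP.<-≤-trans (NP.n<1+n N) (NP.≤-trans M≤a+m (NP.+-monoʳ-≤ a (NP.n≤1+n m))))))
                                (zeroʳ _)

    ∑∑cP≈expTrunc⋆WTrunc : ∀ M h → ∑< M (λ a → ∑< M (λ m → cP a m * powAd a m h)) ≈ (expTrunc M ⋆ WTrunc M) h
    ∑∑cP≈expTrunc⋆WTrunc M h = begin
      ∑< M (λ a → ∑< M (λ m → cP a m * powAd a m h))
        ≈⟨ ∑<-cong M (λ a → ∑<-cong M (λ m → sym (∑-Δ-term a m h))) ⟩
      ∑< M (λ a → ∑< M (λ m → ∑₂ (Δ h) (λ l y → (invFact a * pow a r l) * WTerm m y)))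
        ≈⟨ ∑<-cong M (λ a → ∑-comm (upTo M) (Δ h) _) ⟩
      ∑< M (λ a → ∑₂ (Δ h) (λ l y → ∑< M (λ m → (invFact a * pow a r l) * WTerm m y)))
        ≈⟨ ∑-comm (upTo M) (Δ h) _ ⟩
      ∑₂ (Δ h) (λ l y → ∑< M (λ a → ∑< M (λ m → (invFact a * pow a r l) * WTerm m y)))
        ≈⟨ ∑-cong (Δ h) (λ p → trans (∑<-cong M (λ a → sym (*-distribˡ-∑ _ (upTo M) _))) (sym (*-distribʳ-∑ _ (upTo M) _))) ⟩
      (expTrunc M ⋆ WTrunc M) h ∎

  -- Truncating both series at the degree of h, the ħ-part of exp⋆(r + ħ x) becomes a finite double sum that factors as e^r ⋆ W_r(x).
  tangent-exp : ∀ (inv : ℕ → Carrier) (inv-spec : ∀ n → ⌜ suc n ⌝ * inv n ≈ 1#) (r x Φ Φ′ : Map) → r [] ≈ 0# → x [] ≈ 0# →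
    (∀ h → Φ h ≈ ∑< (suc (deg h)) (λ n → invFactK K inv n * pow n r h)) →
    (∀ h → Φ′ h ≈ ∑< (suc (deg h)) (λ n → invFactK K inv n * Powers.tangentPow r x n h)) →
    Φ′ ≐ Φ ⋆ W (invFactK K inv) r x
  tangent-exp inv inv-spec r x Φ Φ′ r[] x[] hΦ hΦ′ h = begin
    Φ′ h                                             ≈⟨ hΦ′ h ⟩
    ∑< M (λ n → invFactK K inv n * tangentPow n h)   ≈⟨ tangent-series≈∑∑cP h ⟩
    ∑< M (λ a → ∑< M (λ m → cP a m * powAd a m h))   ≈⟨ ∑∑cP≈expTrunc⋆WTrunc M h ⟩
    (expTrunc M ⋆ WTrunc M) h
      ≈⟨ ⋆-cong-below h (λ l l≤N → sym (trans (hΦ l) (exp≈expTrunc M l (s≤s l≤N)))) (λ y y≤N → sym (W≈WTrunc M y (s≤s y≤N))) ⟩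
    (Φ ⋆ W (invFactK K inv) r x) h                   ∎
    where
    open InvFact inv inv-spec
    open Powers r x
    open ExpTangent inv inv-spec r x r[] x[]
    M : ℕ
    M = suc (deg h)

  proj₁-sumL : ∀ {b} {X : Set b} (xs : List X) (F : X → Carrier × Carrier) → proj₁ (G.sumL (map F xs)) ≡ ∑ xs (λ x → proj₁ (F x))
  proj₁-sumL []       F = P.refl
  proj₁-sumL (x ∷ xs) F = P.cong (proj₁ (F x) +_) (proj₁-sumL xs F)

  proj₂-sumL : ∀ {b} {X : Set b} (xs : List X) (F : X → Carrier × Carrier) → proj₂ (G.sumL (map F xs)) ≡ ∑ xs (λ x → proj₂ (F x))
  proj₂-sumL []       F = P.refl
  proj₂-sumL (x ∷ xs) F = P.cong (proj₂ (F x) +_) (proj₂-sumL xs F)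

  proj₁-ε : ∀ h → proj₁ (G.ε h) ≡ ε h
  proj₁-ε []      = P.refl
  proj₁-ε (_ ∷ _) = P.refl

  proj₂-ε : ∀ h → proj₂ (G.ε h) ≡ 0#
  proj₂-ε []      = P.refl
  proj₂-ε (_ ∷ _) = P.refl

  proj₁-conv : ∀ D (f f′ g g′ : Map) h → proj₁ (G.conv D (lift K f f′) (lift K g g′) h) ≈ conv D f g h
  proj₁-conv D f f′ g g′ h = reflexive (proj₁-sumL (D h) _)

  proj₂-conv : ∀ D (f f′ g g′ : Map) h → proj₂ (G.conv D (lift K f f′) (lift K g g′) h) ≈ conv D f g′ h + conv D f′ g h
  proj₂-conv D f f′ g g′ h = trans (reflexive (proj₂-sumL (D h) _)) (∑-+ (D h) _ _)

  ≺-equation-components : ∀ (Φ Φ′ κ κ′ : Map) → lift K Φ Φ′ G.≐ G.ε G.⊕ (lift K κ κ′ G.≺ lift K Φ Φ′) →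
    (∀ h → Φ h ≈ ε h + (κ ≺ Φ) h) × (∀ h → Φ′ h ≈ (κ ≺ Φ′) h + (κ′ ≺ Φ) h)
  ≺-equation-components Φ Φ′ κ κ′ eq =
    (λ h → trans (proj₁ (eq h)) (+-cong (reflexive (proj₁-ε h)) (proj₁-conv Δ≺ κ κ′ Φ Φ′ h))) ,
    (λ h → trans (proj₂ (eq h)) (trans (+-cong (reflexive (proj₂-ε h)) (proj₂-conv Δ≺ κ κ′ Φ Φ′ h)) (+-identityˡ _)))

  ≻-equation-components : ∀ (Φ Φ′ β β′ : Map) → lift K Φ Φ′ G.≐ G.ε G.⊕ (lift K Φ Φ′ G.≻ lift K β β′) →
    (∀ h → Φ h ≈ ε h + (Φ ≻ β) h) × (∀ h → Φ′ h ≈ (Φ ≻ β′) h + (Φ′ ≻ β) h)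
  ≻-equation-components Φ Φ′ β β′ eq =
    (λ h → trans (proj₁ (eq h)) (+-cong (reflexive (proj₁-ε h)) (proj₁-conv Δ≻ Φ Φ′ β β′ h))) ,
    (λ h → trans (proj₂ (eq h)) (trans (+-cong (reflexive (proj₂-ε h)) (proj₂-conv Δ≻ Φ Φ′ β β′ h)) (+-identityˡ _)))

  proj₁-pow : ∀ (r x : Map) n h → proj₁ (G.pow n (lift K r x) h) ≈ pow n r h
  proj₁-pow r x zero    h = reflexive (proj₁-ε h)
  proj₁-pow r x (suc n) h = trans (reflexive (proj₁-sumL (Δ h) _)) (∑-cong (Δ h) (λ p → *-congˡ (proj₁-pow r x n (proj₂ p))))

  proj₂-pow : ∀ (r x : Map) n h → proj₂ (G.pow n (lift K r x) h) ≈ Powers.tangentPow r x n h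
  proj₂-pow r x zero    h = reflexive (proj₂-ε h)
  proj₂-pow r x (suc n) h = trans (reflexive (proj₂-sumL (Δ h) _))
    (trans (∑-cong (Δ h) (λ p → +-cong (*-congˡ (proj₂-pow r x n (proj₂ p))) (*-congˡ (proj₁-pow r x n (proj₂ p))))) (∑-+ (Δ h) _ _))

  exp-components : ∀ inv (Φ Φ′ r x : Map) → lift K Φ Φ′ G.≐ G.exp⋆ (invFactG K inv) (lift K r x) →
    (∀ h → Φ h ≈ ∑< (suc (deg h)) (λ n → invFactK K inv n * pow n r h)) ×
    (∀ h → Φ′ h ≈ ∑< (suc (deg h)) (λ n → invFactK K inv n * Powers.tangentPow r x n h))
  exp-components inv Φ Φ′ r x eq =
    (λ h → trans (proj₁ (eq h)) (trans (reflexive (proj₁-sumL (upTo (suc (deg h))) _))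
                                       (∑-cong (upTo (suc (deg h))) (λ n → *-congˡ (proj₁-pow r x n h))))) ,
    (λ h → trans (proj₂ (eq h)) (trans (reflexive (proj₂-sumL (upTo (suc (deg h))) _))
                                       (∑-cong (upTo (suc (deg h)))
                                               (λ n → trans (+-cong (*-congˡ (proj₂-pow r x n h)) (zeroˡ _)) (+-identityʳ _)))))

proposition4p7 :
  ∀ {a ℓa c ℓ : Level} (K : CommutativeRing c ℓ) →
  let open CommutativeRing K in
  -- the scalars: a commutative ring in which every positive integer is invertible
  (inv : ℕ → Carrier) → (∀ n → natK K (suc n) * inv n ≈ 1#) →
  -- the (multiplicative structure of the) unital algebra 𝒜 and φ, φ'
  (𝒜 : Monoid a ℓa) →
  (φ φ' : Monoid.Carrier 𝒜 → Carrier) →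
  (∀ x y → Monoid._≈_ 𝒜 x y → φ x ≈ φ y) →
  (∀ x y → Monoid._≈_ 𝒜 x y → φ' x ≈ φ' y) →
  φ (Monoid.ε 𝒜) ≈ 1# → φ' (Monoid.ε 𝒜) ≈ 0# →
  let open Extensions K 𝒜 φ φ'
      module C = Conv (Monoid.Carrier 𝒜) rawRing
      module G = Conv (Monoid.Carrier 𝒜) (Dual K)
      Φ̃ = lift K Φ Φ'
  in
  -- Φ⁻¹ : the ⋆-inverse of Φ
  (Φinv : C.H → Carrier) → (Φinv C.⋆ Φ) C.≐ C.ε → (Φ C.⋆ Φinv) C.≐ C.ε →
  (κ κ' β β' ρ ρ' : C.H → Carrier) →
  G.IsInfChar (lift K κ κ') → Φ̃ G.≐ G.ε G.⊕ (lift K κ κ' G.≺ Φ̃) →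
  G.IsInfChar (lift K β β') → Φ̃ G.≐ G.ε G.⊕ (Φ̃ G.≻ lift K β β') →
  G.IsInfChar (lift K ρ ρ') → Φ̃ G.≐ G.exp⋆ (invFactG K inv) (lift K ρ ρ') →
  (Φ' C.≐ Φ C.⋆ C.θ Φinv Φ κ')
  × (Φ' C.≐ C.θ Φ Φinv β' C.⋆ Φ)
  × (Φ' C.≐ Φ C.⋆ C.W (invFactK K inv) ρ ρ')
proposition4p7 K inv inv-spec 𝒜 φ φ′ _ _ _ _ Φinv Φinv⋆Φ≈ε Φ⋆Φinv≈ε κ κ′ β β′ ρ ρ′ _ κ̃-eq _ β̃-eq ρ̃-inf ρ̃-eq =
    uncurry (tangent-≺-solution Φ Φ' Φinv κ κ′ Φ⋆Φinv≈ε) (≺-equation-components Φ Φ' κ κ′ κ̃-eq)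
  , uncurry (tangent-≻-solution Φ Φ' Φinv β β′ Φinv⋆Φ≈ε) (≻-equation-components Φ Φ' β β′ β̃-eq)
  , uncurry (tangent-exp inv inv-spec ρ ρ′ Φ Φ' (proj₁ (proj₁ ρ̃-inf)) (proj₂ (proj₁ ρ̃-inf))) (exp-components inv Φ Φ' ρ ρ′ ρ̃-eq)
  where
  open Extensions K 𝒜 φ φ′
  open Convolution K (Monoid.Carrier 𝒜)
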